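{- Let $\Gamma$ be a connected proper LDDG with exactly three distinct eigenvalues. Then $\Gamma$ is isomorphic either to a complete multipartite graph $K_{n,n,\ldots,n}$ (all parts of the same size $n$) or to the graph $\widetilde{K_{n,n,\ldots,n}}$ obtained from it by adding a loop at every vertex.
   Context: Graphs here are finite, undirected, without multiple edges, but loops are allowed: a vertex may be adjacent to itself. For a vertex $x$, $\Gamma(x)$ is the set of vertices adjacent to $x$ (containing $x$ iff $x$ has a loop), and the degree of $x$ is $|\Gamma(x)|$ (a loop contributes exactly 1). Common neighbours of $x,y$ are the elements of $\Gamma(x)\cap\Gamma(y)$. Eigenvalues of a graph are those of its symmetric 0/1 adjacency matrix (diagonal entry 1 iff loop). A $k$-regular graph on $v$ vertices is an LDDG with parameters $(v,k,\lambda_1,\lambda_2,m,n)$ if its vertex set can be partitioned into $m$ classes of size $n$ such that any two distinct vertices of the same class have exactly $\lambda_1$ common neighbours and any two vertices of different classes have exactly $\lambda_2$ common neighbours. It is proper if $m,n\geq 2$ and $\lambda_1\neq\lambda_2$. -}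

module Defs where

open import Level using (Level; _⊔_)
open import Data.Nat as ℕ using (ℕ; zero; suc)
open import Data.Bool using (Bool; true; false; _∧_; _∨_; not; if_then_else_)
open import Data.Fin using (Fin; zero; suc; _≟_)
open import Data.Product using (Σ; ∃; _×_; _,_)
open import Data.Sum using (_⊎_)
open import Data.List using (List; []; _∷_; length)
open import Relation.Nullary using (¬_)
open import Relation.Nullary.Decidable using (⌊_⌋)
open import Relation.Binary.PropositionalEquality using (_≡_; _≢_)
open import Relation.Binary.Construct.Closure.ReflexiveTransitive using (Star)
open import Algebra.Bundles using (CommutativeRing)
open import Function.Bundles using (_↔_; Inverse)

-- Real closed fields (eigenvalues of real symmetric matrices live in ℝ;
-- we quantify over every real closed field, ℝ being the intended model).

module _ {c ℓ} (R : CommutativeRing c ℓ) where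
  open CommutativeRing R
  evalPoly : List Carrier → Carrier → Carrier
  evalPoly []       x = 0#
  evalPoly (a ∷ as) x = a + x * evalPoly as x

  pow : Carrier → ℕ → Carrier
  pow x zero    = 1#
  pow x (suc n) = x * pow x n

record RealClosedField (c ℓ ℓ' : Level) : Set (Level.suc (c ⊔ ℓ ⊔ ℓ')) where
  field
    commRing : CommutativeRing c ℓ
  open CommutativeRing commRing public
  field
    _≤_        : Carrier → Carrier → Set ℓ'
    0≉1        : ¬ (0# ≈ 1#)
    inverse    : ∀ x → ¬ (x ≈ 0#) → ∃ λ y → x * y ≈ 1#
    ≤-resp-≈   : ∀ {x x' y y'} → x ≈ x' → y ≈ y' → x ≤ y → x' ≤ y'
    ≤-refl     : ∀ {x} → x ≤ x
    ≤-trans    : ∀ {x y z} → x ≤ y → y ≤ z → x ≤ z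
    ≤-antisym  : ∀ {x y} → x ≤ y → y ≤ x → x ≈ y
    ≤-total    : ∀ x y → x ≤ y ⊎ y ≤ x
    +-mono-≤   : ∀ {x y} z → x ≤ y → (x + z) ≤ (y + z)
    *-nonneg   : ∀ {x y} → 0# ≤ x → 0# ≤ y → 0# ≤ (x * y)
    sqrt       : ∀ x → 0# ≤ x → ∃ λ y → y * y ≈ x
    oddRoot    : ∀ (d : ℕ) (cs : List Carrier) → length cs ≡ d →
                 (∃ λ j → d ≡ ℕ.suc (j ℕ.+ j)) →
                 ∃ λ x → (pow commRing x d + evalPoly commRing cs x) ≈ 0#

-- Graphs on Fin v (loops allowed, no multiple edges)

record Graph (v : ℕ) : Set where
  field
    adj : Fin v → Fin v → Bool
    adj-sym : ∀ x y → adj x y ≡ adj y x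
open Graph public

count : ∀ {v} → (Fin v → Bool) → ℕ
count {zero}  p = 0
count {suc v} p = (if p zero then 1 else 0) ℕ.+ count (λ i → p (suc i))

degree : ∀ {v} → Graph v → Fin v → ℕ
degree G x = count (λ w → adj G x w)

commonNeighbours : ∀ {v} → Graph v → Fin v → Fin v → ℕ
commonNeighbours G x y = count (λ w → adj G x w ∧ adj G y w)

Regular : ∀ {v} → Graph v → ℕ → Set
Regular G k = ∀ x → degree G x ≡ k

Connected : ∀ {v} → Graph v → Set
Connected G = ∀ x y → Star (λ a b → adj G a b ≡ true) x y

record LDDGPartition {v} (G : Graph v) (λ₁ λ₂ m n : ℕ) : Set where
  field
    cls        : Fin v → Fin m
    class-size : ∀ i → count (λ x → ⌊ cls x ≟ i ⌋) ≡ n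
    same       : ∀ x y → x ≢ y → cls x ≡ cls y → commonNeighbours G x y ≡ λ₁
    different  : ∀ x y → cls x ≢ cls y → commonNeighbours G x y ≡ λ₂

IsLDDG : ∀ {v} → Graph v → (k λ₁ λ₂ m n : ℕ) → Set
IsLDDG G k λ₁ λ₂ m n = Regular G k × LDDGPartition G λ₁ λ₂ m n

IsProperLDDG : ∀ {v} → Graph v → (k λ₁ λ₂ m n : ℕ) → Set
IsProperLDDG G k λ₁ λ₂ m n =
  IsLDDG G k λ₁ λ₂ m n × (2 ℕ.≤ m) × (2 ℕ.≤ n) × (λ₁ ≢ λ₂)

module _ {c ℓ ℓ'} (R : RealClosedField c ℓ ℓ') where
  open RealClosedField R using (Carrier; _≈_; _+_; _*_; 0#; 1#)

  sumF : ∀ {v} → (Fin v → Carrier) → Carrier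
  sumF {zero}  f = 0#
  sumF {suc v} f = f zero + sumF (λ i → f (suc i))

  entry : Bool → Carrier
  entry true  = 1#
  entry false = 0#

  IsEigenvalue : ∀ {v} → Graph v → Carrier → Set (c ⊔ ℓ)
  IsEigenvalue {v} G μ =
    Σ (Fin v → Carrier) λ x →
      (∃ λ i → ¬ (x i ≈ 0#)) ×
      (∀ i → sumF (λ j → entry (adj G i j) * x j) ≈ μ * x i)

  HasExactlyThreeEigenvalues : ∀ {v} → Graph v → Set (c ⊔ ℓ)
  HasExactlyThreeEigenvalues G =
    Σ Carrier λ θ₁ → Σ Carrier λ θ₂ → Σ Carrier λ θ₃ →
      ¬ (θ₁ ≈ θ₂) × ¬ (θ₁ ≈ θ₃) × ¬ (θ₂ ≈ θ₃) ×
      IsEigenvalue G θ₁ × IsEigenvalue G θ₂ × IsEigenvalue G θ₃ ×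
      (∀ μ → IsEigenvalue G μ → (μ ≈ θ₁) ⊎ (μ ≈ θ₂) ⊎ (μ ≈ θ₃))

-- Complete multipartite graphs K_{n,…,n} (m parts of size n), vertex set
-- Fin m × Fin n, and the version with a loop at every vertex.

multipartiteAdj : ∀ {m n} → Fin m × Fin n → Fin m × Fin n → Bool
multipartiteAdj (i , a) (j , b) = not ⌊ i ≟ j ⌋

loopedMultipartiteAdj : ∀ {m n} → Fin m × Fin n → Fin m × Fin n → Bool
loopedMultipartiteAdj (i , a) (j , b) = not ⌊ i ≟ j ⌋ ∨ (⌊ i ≟ j ⌋ ∧ ⌊ a ≟ b ⌋)

IsomorphicTo : ∀ {v} {V : Set} → Graph v → (V → V → Bool) → Set
IsomorphicTo {v} {V} G A =
  Σ (Fin v ↔ V) λ f → ∀ x y → adj G x y ≡ A (Inverse.to f x) (Inverse.to f y)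

-- Write A for the adjacency matrix.  In an LDDG, A² = b I + (λ₁ − λ₂) B + λ₂ J with b = k − λ₁,
-- B the block matrix of the classes and J the all-ones matrix.  Hence differences e_x − e_y of two
-- vertices of one class are A²-eigenvectors for b, differences of two class indicators are
-- A²-eigenvectors for a = b + n (λ₁ − λ₂), and the all-ones vector is an A-eigenvector for k.
-- If A² = s² on a family of vectors w, then A w + s w and A w − s w are A-eigenvectors for s and −s,
-- so either A acts as the same square root of s² on the whole family, or both ±s are eigenvalues.
-- When λ₂ ≠ 0 the numbers k², b and a are distinct, so the second alternative would produce four
-- eigenvalues; when λ₂ = 0 we have a = k², and connectedness forces A = −k on class differences.
-- Thus A acts as a scalar γ on all the e_x − e_y and as a scalar β on all class differences.
-- Reading these two eigen-equations entrywise shows that adjacency only depends on whether two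
-- vertices are equal, in one class, or in different classes; connectedness makes different classes
-- adjacent, and γ² = b ≠ a = β² makes each class independent.
--
-- Equality in a real closed field need not be decidable, so these case distinctions are made under
-- double negation; everything concluded from them is a Boolean adjacency fact, and hence stable.

module Submission where

open import Defs

open import Axiom.UniquenessOfIdentityProofs using (module Decidable⇒UIP)
open import Data.Bool as Bool using (Bool; true; false; T; not; _∧_; if_then_else_)
open import Data.Bool.Properties using (T-irrelevant; ∧-idem; ¬-not)
open import Data.Empty using (⊥; ⊥-elim)
open import Data.Fin using (Fin; zero; suc; _≟_; punchIn)
open import Data.Fin.Patterns using (0F; 1F; 2F; 3F)
open import Data.Fin.Properties using (0↔⊥; 1↔⊤; +↔⊎; ¬Fin0; punchInᵢ≢i; <⇒notInjective; nonZeroIndex)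
open import Data.Nat as ℕ using (ℕ; zero; suc; z≤n; s≤s)
import Data.Nat.Properties as ℕₚ
open import Data.Product using (Σ; Σ-syntax; ∃; ∃₂; _×_; _,_; proj₁; proj₂)
open import Data.Product.Function.Dependent.Propositional as Σ using ()
open import Data.Product.Properties using (×-≡,≡→≡)
open import Data.Sum using (_⊎_; inj₁; inj₂)
open import Data.Sum.Function.Propositional using (_⊎-↔_)
open import Function using (_∘_; _↔_; Inverse; Injection; mk↔ₛ′)
open import Function.Definitions using (Injective)
open import Function.Properties.Inverse using (↔-sym; ↔-trans; ↔⇒↣)
open import Level using (Level; _⊔_)
open import Relation.Binary.Construct.Closure.ReflexiveTransitive using (Star; ε; _◅_)
open import Relation.Binary.PropositionalEquality as ≡ using (_≡_; _≢_; refl)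
open import Relation.Nullary using (¬_; Dec; yes; no)
open import Relation.Nullary.Decidable
  using (⌊_⌋; True-↔; toWitness; fromWitnessFalse; decidable-stable; ¬¬-excluded-middle)
open import Relation.Nullary.Negation using (¬¬-map)

private
  variable
    ℓa ℓb ℓp : Level
    A : Set ℓa
    B : Set ℓb
    v m n : ℕ

-- The library's ¬¬-Monad lives in a single universe level; do-notation below mixes levels.
infixl 1 _>>=_

_>>=_ : ¬ ¬ A → (A → ¬ ¬ B) → ¬ ¬ B
(¬¬a >>= f) ¬b = ¬¬a (λ a → f a ¬b)

pure : A → ¬ ¬ A
pure a ¬a = ¬a a

Bool-stable : {s t : Bool} → ¬ ¬ (s ≡ t) → s ≡ t
Bool-stable = decidable-stable (_ Bool.≟ _)

¬¬-∀Fin : {P : Fin n → Set ℓp} → (∀ i → ¬ ¬ P i) → ¬ ¬ (∀ i → P i)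
¬¬-∀Fin {zero}  _   = pure λ ()
¬¬-∀Fin {suc n} ¬¬P = do
  P₀ ← ¬¬P zero
  P₊ ← ¬¬-∀Fin (¬¬P ∘ suc)
  pure λ { zero → P₀ ; (suc i) → P₊ i }

two-elements : 2 ℕ.≤ m → ∃₂ λ (i j : Fin m) → i ≢ j
two-elements {suc zero}    (s≤s ())
two-elements {suc (suc _)} _ = zero , suc zero , λ ()

count-cong : {p q : Fin v → Bool} → (∀ x → p x ≡ q x) → count p ≡ count q
count-cong {zero}  _   = refl
count-cong {suc v} p≗q = ≡.cong₂ (λ b c → (if b then 1 else 0) ℕ.+ c) (p≗q zero) (count-cong (p≗q ∘ suc))

count-split : (p : Fin v → Bool) → count p ℕ.+ count (not ∘ p) ≡ v
count-split {zero}  p = refl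
count-split {suc v} p with p zero
... | true  = ≡.cong suc (count-split (p ∘ suc))
... | false = ≡.trans (ℕₚ.+-suc (count (p ∘ suc)) _) (≡.cong suc (count-split (p ∘ suc)))

Σ-Fin-suc-↔ : {P : Fin (suc n) → Set ℓp} → Σ (Fin (suc n)) P ↔ (P zero ⊎ Σ (Fin n) (P ∘ suc))
Σ-Fin-suc-↔ {n} {P = P} =
  mk↔ₛ′ to from (λ { (inj₁ _) → refl ; (inj₂ _) → refl }) (λ { (zero , _) → refl ; (suc _ , _) → refl })
  where
  to : Σ (Fin (suc n)) P → P zero ⊎ Σ (Fin n) (P ∘ suc)
  to (zero  , p) = inj₁ p
  to (suc i , p) = inj₂ (i , p)
  from : P zero ⊎ Σ (Fin n) (P ∘ suc) → Σ (Fin (suc n)) P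
  from (inj₁ p)       = zero , p
  from (inj₂ (i , p)) = suc i , p

T↔Fin : ∀ b → T b ↔ Fin (if b then 1 else 0)
T↔Fin true  = ↔-sym 1↔⊤
T↔Fin false = ↔-sym 0↔⊥

count-↔ : (p : Fin v → Bool) → Σ (Fin v) (T ∘ p) ↔ Fin (count p)
count-↔ {zero}  p = mk↔ₛ′ (λ { (() , _) }) (λ ()) (λ ()) (λ { (() , _) })
count-↔ {suc v} p = ↔-trans Σ-Fin-suc-↔ (↔-trans (T↔Fin (p zero) ⊎-↔ count-↔ (p ∘ suc)) (↔-sym +↔⊎))

member⇒count-pos : (p : Fin v → Bool) {x : Fin v} → T (p x) → 1 ℕ.≤ count p
member⇒count-pos p {x} px with count p | count-↔ p
... | zero  | p↔ = ⊥-elim (¬Fin0 (Inverse.to p↔ (x , px)))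
... | suc _ | _  = s≤s z≤n

two-members : (p : Fin v → Bool) → 2 ℕ.≤ count p → ∃₂ λ x y → x ≢ y × T (p x) × T (p y)
two-members {v} p 2≤count with count p | count-↔ p | 2≤count
... | suc zero    | _  | s≤s ()
... | suc (suc _) | p↔ | _ = x , y , x≢y , px , py
  where
  open Inverse p↔
  x y : Fin v
  x = proj₁ (from zero)
  y = proj₁ (from (suc zero))
  px : T (p x)
  px = proj₂ (from zero)
  py : T (p y)
  py = proj₂ (from (suc zero))
  member-≡ : ∀ {x y} {px : T (p x)} {py : T (p y)} → x ≡ y → (x , px) ≡ (y , py)
  member-≡ refl = ≡.cong (_ ,_) (T-irrelevant _ _)
  x≢y : x ≢ y
  x≢y x≡y with ≡.trans (≡.sym (strictlyInverseˡ zero))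
                       (≡.trans (≡.cong to (member-≡ x≡y)) (strictlyInverseˡ (suc zero)))
  ... | ()

fibres-↔ : (f : A → B) → A ↔ Σ B (λ y → Σ A (λ x → f x ≡ y))
fibres-↔ f = mk↔ₛ′ (λ x → f x , x , refl) (proj₁ ∘ proj₂) (λ { (_ , _ , refl) → refl }) (λ _ → refl)

record IsCompleteMultipartite (G : Graph v) (cls : Fin v → Fin m) : Set where
  field
    uniform-loops      : ∀ x y → adj G x x ≡ adj G y y
    adjacent-across    : ∀ x y → cls x ≢ cls y → adj G x y ≡ true
    nonadjacent-within : ∀ x y → x ≢ y → cls x ≡ cls y → adj G x y ≡ false

module _ {G : Graph v} {cls : Fin v → Fin m} where

  open IsCompleteMultipartite

  IsCompleteMultipartite-stable : ¬ ¬ IsCompleteMultipartite G cls → IsCompleteMultipartite G cls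
  IsCompleteMultipartite-stable ¬¬shape = record
    { uniform-loops      = λ x y → Bool-stable (¬¬-map (λ shape → uniform-loops shape x y) ¬¬shape)
    ; adjacent-across    = λ x y x≁y → Bool-stable (¬¬-map (λ shape → adjacent-across shape x y x≁y) ¬¬shape)
    ; nonadjacent-within = λ x y x≢y x~y →
        Bool-stable (¬¬-map (λ shape → nonadjacent-within shape x y x≢y x~y) ¬¬shape)
    }

module _ {cls : Fin v → Fin m} (class-size : ∀ i → count (λ x → ⌊ cls x ≟ i ⌋) ≡ n) where

  class-↔ : ∀ i → Σ (Fin v) (λ x → cls x ≡ i) ↔ Fin n
  class-↔ i = ↔-trans (Σ.congˡ (↔-sym (True-↔ (_ ≟ i) (Decidable⇒UIP.≡-irrelevant _≟_))))
                      (≡.subst (λ k → _ ↔ Fin k) (class-size i) (count-↔ _))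

  partition-↔ : Fin v ↔ (Fin m × Fin n)
  partition-↔ = ↔-trans (fibres-↔ cls) (Σ.congˡ (class-↔ _))

  module _ {G : Graph v} (shape : IsCompleteMultipartite G cls) where

    open IsCompleteMultipartite shape
    open Inverse partition-↔

    -- The first component of `to x` computes to `cls x`, so both adjacency functions reduce
    -- as soon as `cls x ≟ cls y` is decided.
    complete-multipartite-iso : Fin v →
      IsomorphicTo G (multipartiteAdj {m} {n}) ⊎ IsomorphicTo G (loopedMultipartiteAdj {m} {n})
    complete-multipartite-iso x₀ with adj G x₀ x₀ in loop₀
    ... | false = inj₁ (partition-↔ , without-loops)
      where
      without-loops : ∀ x y → adj G x y ≡ multipartiteAdj (to x) (to y)
      without-loops x y with cls x ≟ cls y
      ... | no x≁y = adjacent-across x y x≁y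
      ... | yes x~y with x ≟ y
      ...   | yes refl = ≡.trans (uniform-loops x x₀) loop₀
      ...   | no x≢y   = nonadjacent-within x y x≢y x~y
    ... | true = inj₂ (partition-↔ , with-loops)
      where
      with-loops : ∀ x y → adj G x y ≡ loopedMultipartiteAdj (to x) (to y)
      with-loops x y with cls x ≟ cls y
      ... | no x≁y = adjacent-across x y x≁y
      ... | yes x~y with proj₂ (to x) ≟ proj₂ (to y) | x ≟ y
      ...   | yes _     | yes refl = ≡.trans (uniform-loops x x₀) loop₀
      ...   | no idx≢   | yes refl = ⊥-elim (idx≢ refl)
      ...   | yes idx≡  | no x≢y   =
        ⊥-elim (x≢y (Injection.injective (↔⇒↣ partition-↔) (×-≡,≡→≡ (x~y , idx≡))))
      ...   | no _      | no x≢y   = nonadjacent-within x y x≢y x~y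

module _ {c ℓ ℓ'} (R : RealClosedField c ℓ ℓ') where

  open RealClosedField R hiding (_≤_; refl; zero) renaming (reflexive to ≈-reflexive)
  open RealClosedField R using () renaming (refl to ≈-refl)
  open import Algebra.Properties.Ring ring
    using (-‿involutive; -‿distribˡ-*; -‿distribʳ-*; -1*x≈-x; +-cancelˡ; x∙y⁻¹≈ε⇒x≈y; +-inverseˡ-unique;
           x[y-z]≈xy-xz; //-rightDividesˡ; //-rightDividesʳ; -0#≈0#; ⁻¹-anti-homo‿-; +-cancelʳ; -‿injective;
           x≈y⇒x∙y⁻¹≈ε)
  open import Algebra.Properties.Semiring.Sum semiring
    using (sum; sum-cong-≋; sum-remove; sum-replicate; sum-replicate-zero; *-distribˡ-sum; *-distribʳ-sum;
           ∑-distrib-+; ∑-comm)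
  import Algebra.Properties.Semiring.Mult semiring as Mult
  open import Relation.Binary.Reasoning.Setoid setoid

  infix 4 _≤_
  _≤_ : Carrier → Carrier → Set ℓ'
  _≤_ = RealClosedField._≤_ R

  private
    variable
      x y z : Carrier
      f g : Fin v → Carrier

  fromℕ : ℕ → Carrier
  fromℕ n = n Mult.× 1#

  𝟙 : Bool → Carrier
  𝟙 = entry R

  0≤-x⇒x≤0 : 0# ≤ - x → x ≤ 0#
  0≤-x⇒x≤0 {x} 0≤-x = ≤-resp-≈ (+-identityˡ x) (-‿inverseˡ x) (+-mono-≤ x 0≤-x)

  x≤0⇒0≤-x : x ≤ 0# → 0# ≤ - x
  x≤0⇒0≤-x {x} x≤0 = ≤-resp-≈ (-‿inverseʳ x) (+-identityˡ (- x)) (+-mono-≤ (- x) x≤0)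

  x≤y⇒0≤y-x : x ≤ y → 0# ≤ y - x
  x≤y⇒0≤y-x {x} x≤y = ≤-resp-≈ (-‿inverseʳ x) ≈-refl (+-mono-≤ (- x) x≤y)

  x≤x+y : 0# ≤ y → x ≤ x + y
  x≤x+y {y} {x} 0≤y = ≤-resp-≈ (+-identityˡ x) (+-comm y x) (+-mono-≤ x 0≤y)

  +-nonneg : 0# ≤ x → 0# ≤ y → 0# ≤ x + y
  +-nonneg 0≤x 0≤y = ≤-trans 0≤x (x≤x+y 0≤y)

  -x*-x≈x*x : ∀ x → - x * - x ≈ x * x
  -x*-x≈x*x x = begin
    - x * - x    ≈⟨ -‿distribˡ-* x (- x) ⟨
    - (x * - x)  ≈⟨ -‿cong (-‿distribʳ-* x x) ⟨
    - - (x * x)  ≈⟨ -‿involutive (x * x) ⟩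
    x * x        ∎

  0≤x*x : ∀ x → 0# ≤ x * x
  0≤x*x x with ≤-total 0# x
  ... | inj₁ 0≤x = *-nonneg 0≤x 0≤x
  ... | inj₂ x≤0 = ≤-resp-≈ ≈-refl (-x*-x≈x*x x) (*-nonneg (x≤0⇒0≤-x x≤0) (x≤0⇒0≤-x x≤0))

  0≤1 : 0# ≤ 1#
  0≤1 = ≤-resp-≈ ≈-refl (*-identityˡ 1#) (0≤x*x 1#)

  0≤𝟙 : ∀ b → 0# ≤ 𝟙 b
  0≤𝟙 false = ≤-refl
  0≤𝟙 true  = 0≤1

  𝟙-injective : ∀ {s t} → 𝟙 s ≈ 𝟙 t → s ≡ t
  𝟙-injective {false} {false} _  = refl
  𝟙-injective {false} {true}  0≈1 = ⊥-elim (0≉1 0≈1)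
  𝟙-injective {true}  {false} 1≈0 = ⊥-elim (0≉1 (sym 1≈0))
  𝟙-injective {true}  {true}  _  = refl

  x*y≈0⇒x≈0 : x * y ≈ 0# → ¬ (y ≈ 0#) → x ≈ 0#
  x*y≈0⇒x≈0 {x} {y} xy≈0 y≉0 with inverse y y≉0
  ... | y⁻¹ , yy⁻¹≈1 = begin
    x               ≈⟨ *-identityʳ x ⟨
    x * 1#          ≈⟨ *-congˡ yy⁻¹≈1 ⟨
    x * (y * y⁻¹)   ≈⟨ *-assoc x y y⁻¹ ⟨
    (x * y) * y⁻¹   ≈⟨ *-congʳ xy≈0 ⟩
    0# * y⁻¹        ≈⟨ zeroˡ y⁻¹ ⟩
    0#              ∎

  *-cancelˡ : ¬ (x ≈ 0#) → x * y ≈ x * z → y ≈ z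
  *-cancelˡ {x} {y} {z} x≉0 xy≈xz = x∙y⁻¹≈ε⇒x≈y y z (x*y≈0⇒x≈0 (begin
    (y - z) * x      ≈⟨ *-comm (y - z) x ⟩
    x * (y - z)      ≈⟨ distribˡ x y (- z) ⟩
    x * y + x * - z  ≈⟨ +-cong xy≈xz (sym (-‿distribʳ-* x z)) ⟩
    x * z - x * z    ≈⟨ -‿inverseʳ (x * z) ⟩
    0#               ∎) x≉0)

  1≉0 : ¬ (1# ≈ 0#)
  1≉0 1≈0 = 0≉1 (sym 1≈0)

  1-0≈1 : x ≈ 1# → y ≈ 0# → x - y ≈ 1#
  1-0≈1 x≈1 y≈0 = trans (+-cong x≈1 (trans (-‿cong y≈0) -0#≈0#)) (+-identityʳ 1#)

  1-0≉0 : x ≈ 1# → y ≈ 0# → ¬ (x - y ≈ 0#)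
  1-0≉0 x≈1 y≈0 x-y≈0 = 1≉0 (trans (sym (1-0≈1 x≈1 y≈0)) x-y≈0)

  x-[x-y]≈y : ∀ x y → x - (x - y) ≈ y
  x-[x-y]≈y x y = begin
    x - (x - y)     ≈⟨ +-congˡ (⁻¹-anti-homo‿- x y) ⟩
    x + (y - x)     ≈⟨ +-comm x (y - x) ⟩
    (y - x) + x     ≈⟨ //-rightDividesˡ x y ⟩
    y               ∎

  [x+y]-z≈[x-z]+y : ∀ x y z → (x + y) - z ≈ (x - z) + y
  [x+y]-z≈[x-z]+y x y z = begin
    (x + y) - z    ≈⟨ +-assoc x y (- z) ⟩
    x + (y - z)    ≈⟨ +-congˡ (+-comm y (- z)) ⟩
    x + (- z + y)  ≈⟨ +-assoc x (- z) y ⟨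
    (x - z) + y    ∎

  x-y≈z⇒x-z≈y : x - y ≈ z → x - z ≈ y
  x-y≈z⇒x-z≈y {x} {y} x-y≈z = trans (+-congˡ (-‿cong (sym x-y≈z))) (x-[x-y]≈y x y)

  x-z≈y-z⇒x≈y : x - z ≈ y - z → x ≈ y
  x-z≈y-z⇒x≈y {x} {z} {y} eq = +-cancelʳ (- z) x y eq

  x-y≈x′-z⇒y≈z : ∀ {x′} → x ≈ x′ → x - y ≈ x′ - z → y ≈ z
  x-y≈x′-z⇒y≈z {x} {y} {z} {x′} x≈x′ eq =
    -‿injective (+-cancelˡ x′ (- y) (- z) (trans (+-congʳ (sym x≈x′)) eq))

  fromℕ-nonneg : ∀ n → 0# ≤ fromℕ n
  fromℕ-nonneg zero    = ≤-refl
  fromℕ-nonneg (suc n) = +-nonneg 0≤1 (fromℕ-nonneg n)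

  fromℕ-suc≉0 : ∀ n → ¬ (fromℕ (suc n) ≈ 0#)
  fromℕ-suc≉0 n 1+n≈0 = 0≉1 (≤-antisym 0≤1 (≤-resp-≈ ≈-refl 1+n≈0 (x≤x+y (fromℕ-nonneg n))))

  fromℕ-nonZero : .{{ℕ.NonZero n}} → ¬ (fromℕ n ≈ 0#)
  fromℕ-nonZero {suc n} = fromℕ-suc≉0 n

  fromℕ-injective : ∀ {m n} → fromℕ m ≈ fromℕ n → m ≡ n
  fromℕ-injective {zero}  {zero}  _  = refl
  fromℕ-injective {zero}  {suc n} eq = ⊥-elim (fromℕ-suc≉0 n (sym eq))
  fromℕ-injective {suc m} {zero}  eq = ⊥-elim (fromℕ-suc≉0 m eq)
  fromℕ-injective {suc m} {suc n} eq = ≡.cong suc (fromℕ-injective (+-cancelˡ 1# _ _ eq))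

  fromℕ-+ : ∀ m n → fromℕ (m ℕ.+ n) ≈ fromℕ m + fromℕ n
  fromℕ-+ = Mult.×-homo-+ 1#

  fromℕ-* : ∀ m n → fromℕ (m ℕ.* n) ≈ fromℕ m * fromℕ n
  fromℕ-* = Mult.×1-homo-*

  x≈-x⇒x≈0 : x ≈ - x → x ≈ 0#
  x≈-x⇒x≈0 {x} x≈-x = x*y≈0⇒x≈0 (begin
    x * (1# + (1# + 0#))  ≈⟨ *-congˡ (+-congˡ (+-identityʳ 1#)) ⟩
    x * (1# + 1#)         ≈⟨ distribˡ x 1# 1# ⟩
    x * 1# + x * 1#       ≈⟨ +-cong (*-identityʳ x) (*-identityʳ x) ⟩
    x + x                 ≈⟨ +-congˡ x≈-x ⟩
    x - x                 ≈⟨ -‿inverseʳ x ⟩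
    0#                    ∎) (fromℕ-suc≉0 1)

  x+ay≈0⇒x≈[-a]y : ∀ {a} → x + a * y ≈ 0# → x ≈ (- a) * y
  x+ay≈0⇒x≈[-a]y {x} {y} {a} x+ay≈0 = trans (+-inverseˡ-unique x (a * y) x+ay≈0) (-‿distribˡ-* a y)

  argmax : Fin v → (f : Fin v → Carrier) → ∃ λ z → ∀ i → f i ≤ f z
  argmax {suc zero}    _ f = zero , λ { zero → ≤-refl }
  argmax {suc (suc v)} _ f with argmax zero (f ∘ suc)
  ... | z , f≤fz with ≤-total (f zero) (f (suc z))
  ...   | inj₁ f₀≤ = suc z , λ { zero → f₀≤ ; (suc i) → f≤fz i }
  ...   | inj₂ ≤f₀ = zero  , λ { zero → ≤-refl ; (suc i) → ≤-trans (f≤fz i) ≤f₀ }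

  sumF≡sum : (f : Fin v → Carrier) → sumF R f ≡ sum f
  sumF≡sum {zero}  f = refl
  sumF≡sum {suc v} f = ≡.cong (f zero +_) (sumF≡sum (f ∘ suc))

  ∑-nonneg : (∀ i → 0# ≤ f i) → 0# ≤ sum f
  ∑-nonneg {zero}  _   = ≤-refl
  ∑-nonneg {suc v} 0≤f = +-nonneg (0≤f zero) (∑-nonneg (0≤f ∘ suc))

  term≤∑ : (∀ i → 0# ≤ f i) → ∀ i → f i ≤ sum f
  term≤∑ {suc v} 0≤f zero    = x≤x+y (∑-nonneg (0≤f ∘ suc))
  term≤∑ {suc v} {f} 0≤f (suc i) = ≤-trans (term≤∑ (0≤f ∘ suc) i)
    (≤-resp-≈ (+-identityˡ _) ≈-refl (+-mono-≤ (sum (f ∘ suc)) (0≤f zero)))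

  ∑-nonneg-≈0 : (∀ i → 0# ≤ f i) → sum f ≈ 0# → ∀ i → f i ≈ 0#
  ∑-nonneg-≈0 0≤f ∑f≈0 i = ≤-antisym (≤-resp-≈ ≈-refl ∑f≈0 (term≤∑ 0≤f i)) (0≤f i)

  ∑-squares-≈0 : sum (λ i → f i * f i) ≈ 0# → ∀ i → ¬ ¬ (f i ≈ 0#)
  ∑-squares-≈0 {f = f} ∑f²≈0 i fi≉0 =
    fi≉0 (x*y≈0⇒x≈0 (∑-nonneg-≈0 (λ j → 0≤x*x (f j)) ∑f²≈0 i) fi≉0)

  ∑-neg : (f : Fin v → Carrier) → sum (λ i → - f i) ≈ - sum f
  ∑-neg f = begin
    sum (λ i → - f i)       ≈⟨ sum-cong-≋ (λ i → -1*x≈-x (f i)) ⟨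
    sum (λ i → - 1# * f i)  ≈⟨ *-distribˡ-sum (- 1#) f ⟨
    - 1# * sum f            ≈⟨ -1*x≈-x (sum f) ⟩
    - sum f                 ∎

  ∑-distrib-minus : (f g : Fin v → Carrier) → sum (λ i → f i - g i) ≈ sum f - sum g
  ∑-distrib-minus f g = trans (∑-distrib-+ f (λ i → - g i)) (+-congˡ (∑-neg g))

  ∑-concentrated : (f : Fin v → Carrier) (i : Fin v) → (∀ j → j ≢ i → f j ≈ 0#) → sum f ≈ f i
  ∑-concentrated {suc v} f i f≈0 = begin
    sum f                            ≈⟨ sum-remove f ⟩
    f i + sum (f ∘ punchIn i)        ≈⟨ +-congˡ (sum-cong-≋ (λ j → f≈0 (punchIn i j) (punchInᵢ≢i i j))) ⟩
    f i + sum {v} (λ _ → 0#)         ≈⟨ +-congˡ (sum-replicate-zero v) ⟩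
    f i + 0#                         ≈⟨ +-identityʳ (f i) ⟩
    f i                              ∎

  ∑-𝟙 : (p : Fin v → Bool) (x : Carrier) → sum (λ j → 𝟙 (p j) * x) ≈ fromℕ (count p) * x
  ∑-𝟙 {zero}  p x = sym (zeroˡ x)
  ∑-𝟙 {suc v} p x with p zero
  ... | true  = begin
    1# * x + sum (λ j → 𝟙 (p (suc j)) * x)  ≈⟨ +-congˡ (∑-𝟙 (p ∘ suc) x) ⟩
    1# * x + fromℕ (count (p ∘ suc)) * x    ≈⟨ distribʳ x 1# _ ⟨
    (1# + fromℕ (count (p ∘ suc))) * x      ∎
  ... | false = begin
    0# * x + sum (λ j → 𝟙 (p (suc j)) * x)  ≈⟨ +-cong (zeroˡ x) (∑-𝟙 (p ∘ suc) x) ⟩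
    0# + fromℕ (count (p ∘ suc)) * x        ≈⟨ +-identityˡ _ ⟩
    fromℕ (count (p ∘ suc)) * x             ∎

  ∑-const : (x : Carrier) → sum {v} (λ _ → x) ≈ fromℕ v * x
  ∑-const {v} x = begin
    sum {v} (λ _ → x)   ≈⟨ sum-replicate v ⟩
    v Mult.× x          ≈⟨ Mult.×-congʳ v (*-identityˡ x) ⟨
    v Mult.× (1# * x)   ≈⟨ Mult.×-assoc-* v 1# x ⟨
    fromℕ v * x         ∎

  𝟙-∧ : ∀ s t → 𝟙 (s ∧ t) ≈ 𝟙 s * 𝟙 t
  𝟙-∧ false t = sym (zeroˡ (𝟙 t))
  𝟙-∧ true  t = sym (*-identityˡ (𝟙 t))

  𝟙≟-refl : (i : Fin n) → 𝟙 ⌊ i ≟ i ⌋ ≈ 1#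
  𝟙≟-refl i with i ≟ i
  ... | yes _   = ≈-refl
  ... | no i≢i = ⊥-elim (i≢i refl)

  𝟙≟-≢ : {i j : Fin n} → i ≢ j → 𝟙 ⌊ i ≟ j ⌋ ≈ 0#
  𝟙≟-≢ {i = i} {j} i≢j with i ≟ j
  ... | yes i≡j = ⊥-elim (i≢j i≡j)
  ... | no _    = ≈-refl

  δ : Fin v → Fin v → Carrier
  δ i j = 𝟙 ⌊ j ≟ i ⌋

  ⟨_,_⟩ : (Fin v → Carrier) → (Fin v → Carrier) → Carrier
  ⟨ u , w ⟩ = sum (λ i → u i * w i)

  ∑-δ : (f : Fin v → Carrier) (i : Fin v) → sum (λ j → f j * δ i j) ≈ f i
  ∑-δ f i = begin
    sum (λ j → f j * δ i j)  ≈⟨ ∑-concentrated _ i (λ j j≢i → trans (*-congˡ (𝟙≟-≢ j≢i)) (zeroʳ _)) ⟩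
    f i * δ i i              ≈⟨ *-congˡ (𝟙≟-refl i) ⟩
    f i * 1#                 ≈⟨ *-identityʳ (f i) ⟩
    f i                      ∎

  ⟨⟩-comm : (f g : Fin v → Carrier) → ⟨ f , g ⟩ ≈ ⟨ g , f ⟩
  ⟨⟩-comm f g = sum-cong-≋ (λ l → *-comm (f l) (g l))

  ⟨⟩-distrib-minus : (f g h : Fin v → Carrier) → ⟨ f , (λ l → g l - h l) ⟩ ≈ ⟨ f , g ⟩ - ⟨ f , h ⟩
  ⟨⟩-distrib-minus f g h = trans (sum-cong-≋ (λ l → x[y-z]≈xy-xz (f l) (g l) (h l)))
                             (∑-distrib-minus (λ l → f l * g l) (λ l → f l * h l))

  ⟨⟩-δ-δ : (f : Fin v → Carrier) (x y : Fin v) → ⟨ f , (λ l → δ x l - δ y l) ⟩ ≈ f x - f y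
  ⟨⟩-δ-δ f x y = trans (⟨⟩-distrib-minus f (δ x) (δ y)) (+-cong (∑-δ f x) (-‿cong (∑-δ f y)))

  module _ {v : ℕ} (G : Graph v) where

    A[_] : (Fin v → Carrier) → Fin v → Carrier
    A[ u ] i = sum (λ j → 𝟙 (adj G i j) * u j)

    eigenvector⇒eigenvalue : ∀ {μ} (u : Fin v → Carrier) (i : Fin v) → ¬ (u i ≈ 0#) →
                 (∀ j → A[ u ] j ≈ μ * u j) → IsEigenvalue R G μ
    eigenvector⇒eigenvalue u i ui≉0 Au≈μu =
      u , (i , ui≉0) , λ j → trans (≈-reflexive (sumF≡sum (λ l → 𝟙 (adj G j l) * u l))) (Au≈μu j)

    A-cong : ∀ {u w} → (∀ j → u j ≈ w j) → ∀ i → A[ u ] i ≈ A[ w ] i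
    A-cong u≈w i = sum-cong-≋ (λ j → *-congˡ (u≈w j))

    A-+ : ∀ u w i → A[ (λ j → u j + w j) ] i ≈ A[ u ] i + A[ w ] i
    A-+ u w i = trans (sum-cong-≋ (λ j → distribˡ _ (u j) (w j)))
                     (∑-distrib-+ (λ j → 𝟙 (adj G i j) * u j) (λ j → 𝟙 (adj G i j) * w j))

    A-* : ∀ t u i → A[ (λ j → t * u j) ] i ≈ t * A[ u ] i
    A-* t u i = begin
      sum (λ j → 𝟙 (adj G i j) * (t * u j))  ≈⟨ sum-cong-≋ (λ j → x*[y*z]≈y*[x*z] (𝟙 (adj G i j)) t (u j)) ⟩
      sum (λ j → t * (𝟙 (adj G i j) * u j))  ≈⟨ *-distribˡ-sum t (λ j → 𝟙 (adj G i j) * u j) ⟨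
      t * A[ u ] i                          ∎
      where
      x*[y*z]≈y*[x*z] : ∀ x y z → x * (y * z) ≈ y * (x * z)
      x*[y*z]≈y*[x*z] x y z = trans (sym (*-assoc x y z)) (trans (*-congʳ (*-comm x y)) (*-assoc y x z))

    A-symmetric : ∀ u w → ⟨ u , A[ w ] ⟩ ≈ ⟨ A[ u ] , w ⟩
    A-symmetric u w = begin
      sum (λ i → u i * sum (λ j → 𝟙 (adj G i j) * w j))
        ≈⟨ sum-cong-≋ (λ i → *-distribˡ-sum (u i) (λ j → 𝟙 (adj G i j) * w j)) ⟩
      sum (λ i → sum (λ j → u i * (𝟙 (adj G i j) * w j)))
        ≈⟨ ∑-comm (λ i j → u i * (𝟙 (adj G i j) * w j)) ⟩
      sum (λ j → sum (λ i → u i * (𝟙 (adj G i j) * w j)))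
        ≈⟨ sum-cong-≋ (λ j → sum-cong-≋ (λ i → rearrange i j)) ⟩
      sum (λ j → sum (λ i → (𝟙 (adj G j i) * u i) * w j))
        ≈⟨ sum-cong-≋ (λ j → *-distribʳ-sum (w j) (λ i → 𝟙 (adj G j i) * u i)) ⟨
      sum (λ j → A[ u ] j * w j) ∎
      where
      rearrange : ∀ i j → u i * (𝟙 (adj G i j) * w j) ≈ (𝟙 (adj G j i) * u i) * w j
      rearrange i j = begin
        u i * (𝟙 (adj G i j) * w j)  ≈⟨ *-assoc (u i) _ (w j) ⟨
        (u i * 𝟙 (adj G i j)) * w j  ≈⟨ *-congʳ (*-comm (u i) _) ⟩
        (𝟙 (adj G i j) * u i) * w j  ≡⟨ ≡.cong (λ b → (𝟙 b * u i) * w j) (adj-sym G i j) ⟩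
        (𝟙 (adj G j i) * u i) * w j  ∎

    A²-commonNeighbours : ∀ u i → A[ A[ u ] ] i ≈ sum (λ l → fromℕ (commonNeighbours G i l) * u l)
    A²-commonNeighbours u i = begin
      sum (λ j → 𝟙 (adj G i j) * sum (λ l → 𝟙 (adj G j l) * u l))
        ≈⟨ sum-cong-≋ (λ j → *-distribˡ-sum (𝟙 (adj G i j)) (λ l → 𝟙 (adj G j l) * u l)) ⟩
      sum (λ j → sum (λ l → 𝟙 (adj G i j) * (𝟙 (adj G j l) * u l)))
        ≈⟨ ∑-comm (λ j l → 𝟙 (adj G i j) * (𝟙 (adj G j l) * u l)) ⟩
      sum (λ l → sum (λ j → 𝟙 (adj G i j) * (𝟙 (adj G j l) * u l)))
        ≈⟨ sum-cong-≋ (λ l → sum-cong-≋ (λ j → walk j l)) ⟩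
      sum (λ l → sum (λ j → 𝟙 (adj G i j ∧ adj G l j) * u l))
        ≈⟨ sum-cong-≋ (λ l → ∑-𝟙 (λ j → adj G i j ∧ adj G l j) (u l)) ⟩
      sum (λ l → fromℕ (commonNeighbours G i l) * u l) ∎
      where
      walk : ∀ j l → 𝟙 (adj G i j) * (𝟙 (adj G j l) * u l) ≈ 𝟙 (adj G i j ∧ adj G l j) * u l
      walk j l = begin
        𝟙 (adj G i j) * (𝟙 (adj G j l) * u l)  ≈⟨ *-assoc _ _ (u l) ⟨
        (𝟙 (adj G i j) * 𝟙 (adj G j l)) * u l  ≈⟨ *-congʳ (𝟙-∧ (adj G i j) (adj G j l)) ⟨
        𝟙 (adj G i j ∧ adj G j l) * u l        ≡⟨ ≡.cong (λ b → 𝟙 (adj G i j ∧ b) * u l) (adj-sym G j l) ⟩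
        𝟙 (adj G i j ∧ adj G l j) * u l        ∎

    A²-factor : ∀ s w → (∀ i → A[ A[ w ] ] i ≈ (s * s) * w i) →
                ∀ i → A[ (λ j → A[ w ] j + s * w j) ] i ≈ s * (A[ w ] i + s * w i)
    A²-factor s w A²w i = begin
      A[ (λ j → A[ w ] j + s * w j) ] i        ≈⟨ A-+ A[ w ] (λ j → s * w j) i ⟩
      A[ A[ w ] ] i + A[ (λ j → s * w j) ] i   ≈⟨ +-cong (A²w i) (A-* s w i) ⟩
      (s * s) * w i + s * A[ w ] i             ≈⟨ +-comm _ _ ⟩
      s * A[ w ] i + (s * s) * w i             ≈⟨ +-congˡ (*-assoc s s (w i)) ⟩
      s * A[ w ] i + s * (s * w i)             ≈⟨ distribˡ s _ _ ⟨
      s * (A[ w ] i + s * w i)                 ∎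

    A²≈0⇒A≈0 : ∀ w → (∀ i → A[ A[ w ] ] i ≈ 0#) → ∀ i → ¬ ¬ (A[ w ] i ≈ 0#)
    A²≈0⇒A≈0 w A²w≈0 = ∑-squares-≈0 (begin
      ⟨ A[ w ] , A[ w ] ⟩       ≈⟨ A-symmetric A[ w ] w ⟩
      ⟨ A[ A[ w ] ] , w ⟩       ≈⟨ sum-cong-≋ (λ i → trans (*-congʳ (A²w≈0 i)) (zeroˡ (w i))) ⟩
      sum {v} (λ _ → 0#)        ≈⟨ sum-replicate-zero v ⟩
      0#                        ∎)

    A²-nonneg : ∀ w c → (∀ i → A[ A[ w ] ] i ≈ c * w i) → ∀ i → ¬ (w i ≈ 0#) → 0# ≤ c
    A²-nonneg w c A²w≈cw i wi≉0 with ≤-total 0# c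
    ... | inj₁ 0≤c = 0≤c
    ... | inj₂ c≤0 = ≤-resp-≈ ≈-refl (sym c≈0) ≤-refl
      where
      c‖w‖²≈‖Aw‖² : c * ⟨ w , w ⟩ ≈ ⟨ A[ w ] , A[ w ] ⟩
      c‖w‖²≈‖Aw‖² = begin
        c * ⟨ w , w ⟩
          ≈⟨ *-distribˡ-sum c (λ j → w j * w j) ⟩
        sum (λ j → c * (w j * w j))
          ≈⟨ sum-cong-≋ (λ j → trans (*-congʳ (A²w≈cw j)) (*-assoc c (w j) (w j))) ⟨
        ⟨ A[ A[ w ] ] , w ⟩
          ≈⟨ A-symmetric A[ w ] w ⟨
        ⟨ A[ w ] , A[ w ] ⟩ ∎
      c‖w‖²≈0 : c * ⟨ w , w ⟩ ≈ 0#
      c‖w‖²≈0 = ≤-antisym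
        (0≤-x⇒x≤0 (≤-resp-≈ ≈-refl (sym (-‿distribˡ-* c _))
          (*-nonneg (x≤0⇒0≤-x c≤0) (∑-nonneg (λ j → 0≤x*x (w j))))))
        (≤-resp-≈ ≈-refl (sym c‖w‖²≈‖Aw‖²) (∑-nonneg (λ j → 0≤x*x (A[ w ] j))))
      c≈0 : c ≈ 0#
      c≈0 = x*y≈0⇒x≈0 c‖w‖²≈0 (λ ‖w‖²≈0 → ∑-squares-≈0 ‖w‖²≈0 i wi≉0)

    BothSigns : Carrier → Set (c ⊔ ℓ)
    BothSigns s = IsEigenvalue R G s × IsEigenvalue R G (- s) × ¬ (s ≈ - s)

    module _ {ι} {I : Set ι} (w : I → Fin v → Carrier) where

      ActsAs : Carrier → Set (ι ⊔ ℓ)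
      ActsAs μ = ∀ a i → ¬ ¬ (A[ w a ] i ≈ μ * w a i)

      Uniform : Carrier → Set (c ⊔ ι ⊔ ℓ)
      Uniform c = ∃ λ μ → μ * μ ≈ c × ActsAs μ

      uniform-eigenvalue : ∀ {μ} → ActsAs μ → ∀ a i → ¬ (w a i ≈ 0#) → ¬ ¬ IsEigenvalue R G μ
      uniform-eigenvalue acts a i wai≉0 = do
        Awa≈μwa ← ¬¬-∀Fin (acts a)
        pure (eigenvector⇒eigenvalue (w a) i wai≉0 Awa≈μwa)

      square-root-dichotomy : ∀ {c} s → s * s ≈ c → (∀ a i → A[ A[ w a ] ] i ≈ c * w a i) →
                              ¬ ¬ (Uniform c ⊎ BothSigns s)
      square-root-dichotomy {c} s s²≈c A²w≈cw = do
        no s≉-s ← ¬¬-excluded-middle {A = s ≈ - s}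
          where yes s≈-s → pure (inj₁ (s , s²≈c , annihilated (x≈-x⇒x≈0 s≈-s)))
        plus?  ← ¬¬-excluded-middle
        minus? ← ¬¬-excluded-middle
        pure (decide plus? minus? s≉-s)
        where
        A²w≈s²w : ∀ a i → A[ A[ w a ] ] i ≈ (s * s) * w a i
        A²w≈s²w a i = trans (A²w≈cw a i) (*-congʳ (sym s²≈c))

        plus minus : I → Fin v → Carrier
        plus  a j = A[ w a ] j + s * w a j
        minus a j = A[ w a ] j + (- s) * w a j

        annihilated : s ≈ 0# → ActsAs s
        annihilated s≈0 a i = do
          Aw≈0 ← A²≈0⇒A≈0 (w a) (λ j → trans (A²w≈s²w a j) (trans (*-congʳ s*s≈0) (zeroˡ (w a j)))) i
          pure (trans Aw≈0 (sym (trans (*-congʳ s≈0) (zeroˡ (w a i)))))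
          where
          s*s≈0 : s * s ≈ 0#
          s*s≈0 = trans (*-congʳ s≈0) (zeroˡ s)

        decide : Dec (∃₂ λ a j → ¬ (plus a j ≈ 0#)) → Dec (∃₂ λ a j → ¬ (minus a j ≈ 0#)) →
                 ¬ (s ≈ - s) → Uniform c ⊎ BothSigns s
        decide (yes (a , j , plus≉0)) (yes (a′ , j′ , minus≉0)) s≉-s = inj₂
          ( eigenvector⇒eigenvalue (plus a) j plus≉0 (A²-factor s (w a) (A²w≈s²w a))
          , eigenvector⇒eigenvalue (minus a′) j′ minus≉0
              (A²-factor (- s) (w a′) (λ i → trans (A²w≈s²w a′ i) (*-congʳ (sym (-x*-x≈x*x s)))))
          , s≉-s )
        decide (no ∄plus) _ _ = inj₁ (- s , trans (-x*-x≈x*x s) s²≈c , λ a i Aw≉-sw →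
          ∄plus (a , i , λ plus≈0 → Aw≉-sw (x+ay≈0⇒x≈[-a]y plus≈0)))
        decide _ (no ∄minus) _ = inj₁ (s , s²≈c , λ a i Aw≉sw →
          ∄minus (a , i , λ minus≈0 → Aw≉sw (trans (x+ay≈0⇒x≈[-a]y minus≈0) (*-congʳ (-‿involutive s)))))

      square-root-eigenvalue : ∀ {c s} a i → ¬ (w a i ≈ 0#) → s * s ≈ c → Uniform c ⊎ BothSigns s →
                               ¬ ¬ (∃ λ μ → μ * μ ≈ c × IsEigenvalue R G μ)
      square-root-eigenvalue a i wai≉0 _ (inj₁ (μ , μ²≈c , acts)) = do
        eig-μ ← uniform-eigenvalue acts a i wai≉0
        pure (μ , μ²≈c , eig-μ)
      square-root-eigenvalue {s = s} _ _ _ s²≈c (inj₂ (eig-s , _)) = pure (s , s²≈c , eig-s)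

    crossing-edge : (f : Fin v → Fin m) {x y : Fin v} → Star (λ s t → adj G s t ≡ true) x y → f x ≢ f y →
                    ∃₂ λ s t → f s ≢ f t × adj G s t ≡ true
    crossing-edge f ε fx≢fx = ⊥-elim (fx≢fx refl)
    crossing-edge f {x} (_◅_ {j = t} x~t walk) fx≢fy with f x ≟ f t
    ... | yes fx≡ft = crossing-edge f walk (fx≢fy ∘ ≡.trans fx≡ft)
    ... | no  fx≢ft = x , t , fx≢ft , x~t

    module _ {k : ℕ} (regular : Regular G k) where

      A-const : ∀ x i → A[ (λ _ → x) ] i ≈ fromℕ k * x
      A-const x i = trans (∑-𝟙 (adj G i) x) (≈-reflexive (≡.cong (λ d → fromℕ d * x) (regular i)))

      ∑-A : ∀ u → sum A[ u ] ≈ fromℕ k * sum u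
      ∑-A u = begin
        sum A[ u ]                   ≈⟨ sum-cong-≋ (λ i → *-identityˡ (A[ u ] i)) ⟨
        ⟨ (λ _ → 1#) , A[ u ] ⟩      ≈⟨ A-symmetric (λ _ → 1#) u ⟩
        ⟨ A[ (λ _ → 1#) ] , u ⟩      ≈⟨ sum-cong-≋ (λ i → *-congʳ (trans (A-const 1# i) (*-identityʳ _))) ⟩
        sum (λ i → fromℕ k * u i)    ≈⟨ *-distribˡ-sum (fromℕ k) u ⟨
        fromℕ k * sum u              ∎

      K-eigenvector-constant : Connected G → ∀ p → (∀ i → A[ p ] i ≈ fromℕ k * p i) → ∀ x y → p x ≈ p y
      K-eigenvector-constant connected p Ap≈Kp x y = trans (≈max x) (sym (≈max y))
        where
        peak : Fin v
        peak = proj₁ (argmax x p)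
        M : Carrier
        M = p peak

        -- At a maximum, p s = (1/k) Σ_{t ~ s} p t forces every neighbour to be a maximum as well.
        neighbour : ∀ {s t} → p s ≈ M → adj G s t ≡ true → p t ≈ M
        neighbour {s} {t} ps≈M s~t = sym (x∙y⁻¹≈ε⇒x≈y M (p t) (begin
          M - p t
            ≈⟨ *-identityˡ (M - p t) ⟨
          1# * (M - p t)
            ≡⟨ ≡.cong (λ b → 𝟙 b * (M - p t)) s~t ⟨
          𝟙 (adj G s t) * (M - p t)
            ≈⟨ ∑-nonneg-≈0 (λ j → *-nonneg (0≤𝟙 (adj G s j)) (x≤y⇒0≤y-x (proj₂ (argmax x p) j))) gaps≈0 t ⟩
          0# ∎))
          where
          gaps≈0 : sum (λ j → 𝟙 (adj G s j) * (M - p j)) ≈ 0#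
          gaps≈0 = begin
            sum (λ j → 𝟙 (adj G s j) * (M - p j))
              ≈⟨ sum-cong-≋ (λ j → x[y-z]≈xy-xz _ M (p j)) ⟩
            sum (λ j → 𝟙 (adj G s j) * M - 𝟙 (adj G s j) * p j)
              ≈⟨ ∑-distrib-minus (λ j → 𝟙 (adj G s j) * M) (λ j → 𝟙 (adj G s j) * p j) ⟩
            A[ (λ _ → M) ] s - A[ p ] s
              ≈⟨ +-cong (A-const M s) (-‿cong (trans (Ap≈Kp s) (*-congˡ ps≈M))) ⟩
            fromℕ k * M - fromℕ k * M
              ≈⟨ -‿inverseʳ _ ⟩
            0# ∎

        ≈max : ∀ x → p x ≈ M
        ≈max x = go (connected peak x) ≈-refl
          where
          go : ∀ {s t} → Star (λ a b → adj G a b ≡ true) s t → p s ≈ M → p t ≈ M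
          go ε        ps≈M = ps≈M
          go (e ◅ es) ps≈M = go es (neighbour ps≈M e)

      A²≈k²⇒A≈-k : Connected G → Fin v →
                   ∀ w → (∀ i → A[ A[ w ] ] i ≈ (fromℕ k * fromℕ k) * w i) → sum w ≈ 0# →
                   ∀ i → A[ w ] i ≈ (- fromℕ k) * w i
      A²≈k²⇒A≈-k connected x w A²w≈k²w ∑w≈0 i = x+ay≈0⇒x≈[-a]y (trans (p-constant i x) p≈0)
        where
        K : Carrier
        K = fromℕ k
        p : Fin v → Carrier
        p j = A[ w ] j + K * w j

        p-constant : ∀ i j → p i ≈ p j
        p-constant = K-eigenvector-constant connected p (A²-factor K w A²w≈k²w)

        ∑p≈0 : sum p ≈ 0#
        ∑p≈0 = begin
          sum p                          ≈⟨ ∑-distrib-+ A[ w ] (λ j → K * w j) ⟩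
          sum A[ w ] + sum (λ j → K * w j)  ≈⟨ +-cong (∑-A w) (sym (*-distribˡ-sum K w)) ⟩
          K * sum w + K * sum w          ≈⟨ +-cong (*-congˡ ∑w≈0) (*-congˡ ∑w≈0) ⟩
          K * 0# + K * 0#                ≈⟨ trans (+-cong (zeroʳ K) (zeroʳ K)) (+-identityʳ 0#) ⟩
          0#                             ∎

        p≈0 : p x ≈ 0#
        p≈0 = x*y≈0⇒x≈0 (begin
          p x * fromℕ v                  ≈⟨ *-comm (p x) (fromℕ v) ⟩
          fromℕ v * p x                  ≈⟨ ∑-const {v} (p x) ⟨
          sum {v} (λ _ → p x)                ≈⟨ sum-cong-≋ (λ j → p-constant x j) ⟩
          sum p                          ≈⟨ ∑p≈0 ⟩
          0#                             ∎) (fromℕ-nonZero {{nonZeroIndex x}})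
    module _ {θ₁ θ₂ θ₃ : Carrier}
             (at-most-three : ∀ μ → IsEigenvalue R G μ → μ ≈ θ₁ ⊎ μ ≈ θ₂ ⊎ μ ≈ θ₃) where

      no-four-eigenvalues : (e : Fin 4 → Carrier) → (∀ i → IsEigenvalue R G (e i)) →
                            (∀ i j → e i ≈ e j → i ≡ j) → ⊥
      no-four-eigenvalues e eig separated = <⇒notInjective (ℕₚ.n<1+n 3) injective
        where
        index : ∀ {μ} → μ ≈ θ₁ ⊎ μ ≈ θ₂ ⊎ μ ≈ θ₃ → Fin 3
        index (inj₁ _)        = 0F
        index (inj₂ (inj₁ _)) = 1F
        index (inj₂ (inj₂ _)) = 2F

        same-index : ∀ {μ ν} (p : μ ≈ θ₁ ⊎ μ ≈ θ₂ ⊎ μ ≈ θ₃) (q : ν ≈ θ₁ ⊎ ν ≈ θ₂ ⊎ ν ≈ θ₃) →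
                     index p ≡ index q → μ ≈ ν
        same-index (inj₁ μ≈θ)        (inj₁ ν≈θ)        _ = trans μ≈θ (sym ν≈θ)
        same-index (inj₂ (inj₁ μ≈θ)) (inj₂ (inj₁ ν≈θ)) _ = trans μ≈θ (sym ν≈θ)
        same-index (inj₂ (inj₂ μ≈θ)) (inj₂ (inj₂ ν≈θ)) _ = trans μ≈θ (sym ν≈θ)
        same-index (inj₁ _)          (inj₂ (inj₁ _))   ()
        same-index (inj₁ _)          (inj₂ (inj₂ _))   ()
        same-index (inj₂ (inj₁ _))   (inj₁ _)          ()
        same-index (inj₂ (inj₁ _))   (inj₂ (inj₂ _))   ()
        same-index (inj₂ (inj₂ _))   (inj₁ _)          ()
        same-index (inj₂ (inj₂ _))   (inj₂ (inj₁ _))   ()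

        injective : Injective _≡_ _≡_ (λ i → index (at-most-three (e i) (eig i)))
        injective {i} {j} same = separated i j (same-index _ _ same)

      both-signs-exclude-two : ∀ {s μ ν} → BothSigns s → IsEigenvalue R G μ → IsEigenvalue R G ν →
                               ¬ (μ ≈ ν) →
                           ¬ (μ * μ ≈ s * s) → ¬ (ν * ν ≈ s * s) → ⊥
      both-signs-exclude-two {s} {μ} {ν} (eig-s , eig-−s , s≉-s) eig-μ eig-ν μ≉ν μ²≉s² ν²≉s² =
        no-four-eigenvalues e eig separated
        where
        e : Fin 4 → Carrier
        e 0F = s
        e 1F = - s
        e 2F = μ
        e 3F = ν

        eig : ∀ i → IsEigenvalue R G (e i)
        eig 0F = eig-s
        eig 1F = eig-−s
        eig 2F = eig-μ
        eig 3F = eig-ν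

        ≉s : ∀ {κ} → ¬ (κ * κ ≈ s * s) → ¬ (κ ≈ s)
        ≉s κ²≉s² κ≈s = κ²≉s² (*-cong κ≈s κ≈s)

        ≉-s : ∀ {κ} → ¬ (κ * κ ≈ s * s) → ¬ (κ ≈ - s)
        ≉-s κ²≉s² κ≈-s = κ²≉s² (trans (*-cong κ≈-s κ≈-s) (-x*-x≈x*x s))

        separated : ∀ i j → e i ≈ e j → i ≡ j
        separated 0F 0F _ = refl
        separated 1F 1F _ = refl
        separated 2F 2F _ = refl
        separated 3F 3F _ = refl
        separated 0F 1F eq = ⊥-elim (s≉-s eq)
        separated 1F 0F eq = ⊥-elim (s≉-s (sym eq))
        separated 2F 3F eq = ⊥-elim (μ≉ν eq)
        separated 3F 2F eq = ⊥-elim (μ≉ν (sym eq))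
        separated 2F 0F eq = ⊥-elim (≉s μ²≉s² eq)
        separated 0F 2F eq = ⊥-elim (≉s μ²≉s² (sym eq))
        separated 3F 0F eq = ⊥-elim (≉s ν²≉s² eq)
        separated 0F 3F eq = ⊥-elim (≉s ν²≉s² (sym eq))
        separated 2F 1F eq = ⊥-elim (≉-s μ²≉s² eq)
        separated 1F 2F eq = ⊥-elim (≉-s μ²≉s² (sym eq))
        separated 3F 1F eq = ⊥-elim (≉-s ν²≉s² eq)
        separated 1F 3F eq = ⊥-elim (≉-s ν²≉s² (sym eq))

    module LDDG {k λ₁ λ₂ m n : ℕ} (regular : Regular G k) (partition : LDDGPartition G λ₁ λ₂ m n) where

      open LDDGPartition partition

      K Λ₁ Λ₂ N b a : Carrier
      K  = fromℕ k
      Λ₁ = fromℕ λ₁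
      Λ₂ = fromℕ λ₂
      N  = fromℕ n
      b  = K - Λ₁
      a  = b + N * (Λ₁ - Λ₂)

      ind : Fin m → Fin v → Carrier
      ind i l = 𝟙 ⌊ cls l ≟ i ⌋

      outside : Fin v → ℕ
      outside z = count (λ l → not ⌊ cls l ≟ cls z ⌋)

      ∑-ind : ∀ i f {t} → (∀ l → cls l ≡ i → f l ≈ t) → ⟨ ind i , f ⟩ ≈ N * t
      ∑-ind i f {t} f≈t = begin
        sum (λ l → ind i l * f l)                       ≈⟨ sum-cong-≋ restrict ⟩
        sum (λ l → ind i l * t)                         ≈⟨ ∑-𝟙 (λ l → ⌊ cls l ≟ i ⌋) t ⟩
        fromℕ (count (λ l → ⌊ cls l ≟ i ⌋)) * t         ≡⟨ ≡.cong (λ c → fromℕ c * t) (class-size i) ⟩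
        N * t                                           ∎
        where
        restrict : ∀ l → ind i l * f l ≈ ind i l * t
        restrict l with cls l ≟ i
        ... | yes cls≡i = *-congˡ (f≈t l cls≡i)
        ... | no  _     = trans (zeroˡ (f l)) (sym (zeroˡ t))

      ∑-ind-except : ∀ z f {t} → (∀ l → cls l ≡ cls z → l ≢ z → f l ≈ t) →
                     ⟨ ind (cls z) , f ⟩ ≈ N * t + (f z - t)
      ∑-ind-except z f {t} f≈t = begin
        ⟨ ind (cls z) , f ⟩
          ≈⟨ sum-cong-≋ (λ l → *-congˡ (sym (split l))) ⟩
        sum (λ l → ind (cls z) l * (t + (f l - t)))
          ≈⟨ sum-cong-≋ (λ l → distribˡ (ind (cls z) l) t _) ⟩
        sum (λ l → ind (cls z) l * t + ind (cls z) l * (f l - t))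
          ≈⟨ ∑-distrib-+ (λ l → ind (cls z) l * t) _ ⟩
        ⟨ ind (cls z) , (λ _ → t) ⟩ + ⟨ ind (cls z) , (λ l → f l - t) ⟩
          ≈⟨ +-cong (∑-ind (cls z) (λ _ → t) (λ _ _ → ≈-refl)) excess ⟩
        N * t + (f z - t) ∎
        where
        split : ∀ l → t + (f l - t) ≈ f l
        split l = trans (+-comm t (f l - t)) (//-rightDividesˡ t (f l))

        vanish : ∀ l → l ≢ z → ind (cls z) l * (f l - t) ≈ 0#
        vanish l l≢z with cls l ≟ cls z
        ... | yes l~z = trans (*-identityˡ _) (x≈y⇒x∙y⁻¹≈ε (f≈t l l~z l≢z))
        ... | no  _   = zeroˡ _

        excess : ⟨ ind (cls z) , (λ l → f l - t) ⟩ ≈ f z - t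
        excess = trans (∑-concentrated _ z vanish) (trans (*-congʳ (𝟙≟-refl (cls z))) (*-identityˡ _))

      [Λ₁-Λ₂]*1+Λ₂≈Λ₁ : ∀ {t} → t ≈ 1# → (Λ₁ - Λ₂) * t + Λ₂ ≈ Λ₁
      [Λ₁-Λ₂]*1+Λ₂≈Λ₁ t≈1 =
        trans (+-congʳ (trans (*-congˡ t≈1) (*-identityʳ _))) (//-rightDividesˡ Λ₂ Λ₁)

      b*0+x≈x : ∀ {d t} → d ≈ 0# → b * d + t ≈ t
      b*0+x≈x d≈0 = trans (+-congʳ (trans (*-congˡ d≈0) (zeroʳ b))) (+-identityˡ _)

      commonNeighbours-LDDG : ∀ z l →
        fromℕ (commonNeighbours G z l) ≈ b * δ z l + ((Λ₁ - Λ₂) * ind (cls z) l + Λ₂)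
      commonNeighbours-LDDG z l with l ≟ z
      ... | yes refl = begin
        fromℕ (commonNeighbours G z z)
          ≡⟨ ≡.cong fromℕ (≡.trans (count-cong (∧-idem ∘ adj G z)) (regular z)) ⟩
        K
          ≈⟨ //-rightDividesˡ Λ₁ K ⟨
        b + Λ₁
          ≈⟨ +-cong (*-identityʳ b) ([Λ₁-Λ₂]*1+Λ₂≈Λ₁ (𝟙≟-refl (cls z))) ⟨
        b * 1# + ((Λ₁ - Λ₂) * ind (cls z) z + Λ₂) ∎
      ... | no l≢z with cls l ≟ cls z
      ...   | yes same-class = begin
        fromℕ (commonNeighbours G z l)
          ≡⟨ ≡.cong fromℕ (same z l (l≢z ∘ ≡.sym) (≡.sym same-class)) ⟩
        Λ₁
          ≈⟨ [Λ₁-Λ₂]*1+Λ₂≈Λ₁ ≈-refl ⟨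
        (Λ₁ - Λ₂) * 1# + Λ₂
          ≈⟨ b*0+x≈x ≈-refl ⟨
        b * 0# + ((Λ₁ - Λ₂) * 1# + Λ₂) ∎
      ...   | no other-class = begin
        fromℕ (commonNeighbours G z l)             ≡⟨ ≡.cong fromℕ (different z l (other-class ∘ ≡.sym)) ⟩
        Λ₂                                         ≈⟨ +-identityˡ Λ₂ ⟨
        0# + Λ₂                                    ≈⟨ +-congʳ (zeroʳ _) ⟨
        (Λ₁ - Λ₂) * 0# + Λ₂                        ≈⟨ b*0+x≈x ≈-refl ⟨
        b * 0# + ((Λ₁ - Λ₂) * 0# + Λ₂)             ∎

      A²-LDDG : ∀ u z → A[ A[ u ] ] z ≈ b * u z + ((Λ₁ - Λ₂) * ⟨ ind (cls z) , u ⟩ + Λ₂ * sum u)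
      A²-LDDG u z = begin
        A[ A[ u ] ] z
          ≈⟨ A²-commonNeighbours u z ⟩
        sum (λ l → fromℕ (commonNeighbours G z l) * u l)
          ≈⟨ sum-cong-≋ expand ⟩
        sum (λ l → b * (u l * δ z l) + rest l)
          ≈⟨ ∑-distrib-+ (λ l → b * (u l * δ z l)) rest ⟩
        sum (λ l → b * (u l * δ z l)) + sum rest
          ≈⟨ +-cong (*-distribˡ-sum b (λ l → u l * δ z l)) ∑rest ⟨
        b * sum (λ l → u l * δ z l) + ((Λ₁ - Λ₂) * ⟨ ind (cls z) , u ⟩ + Λ₂ * sum u)
          ≈⟨ +-congʳ (*-congˡ (∑-δ u z)) ⟩
        b * u z + ((Λ₁ - Λ₂) * ⟨ ind (cls z) , u ⟩ + Λ₂ * sum u) ∎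
        where
        rest : Fin v → Carrier
        rest l = (Λ₁ - Λ₂) * (ind (cls z) l * u l) + Λ₂ * u l

        ∑rest : (Λ₁ - Λ₂) * ⟨ ind (cls z) , u ⟩ + Λ₂ * sum u ≈ sum rest
        ∑rest = trans (+-cong (*-distribˡ-sum (Λ₁ - Λ₂) (λ l → ind (cls z) l * u l)) (*-distribˡ-sum Λ₂ u))
                      (sym (∑-distrib-+ (λ l → (Λ₁ - Λ₂) * (ind (cls z) l * u l)) (λ l → Λ₂ * u l)))

        expand : ∀ l → fromℕ (commonNeighbours G z l) * u l ≈ b * (u l * δ z l) + rest l
        expand l = begin
          fromℕ (commonNeighbours G z l) * u l
            ≈⟨ *-congʳ (commonNeighbours-LDDG z l) ⟩
          (b * δ z l + ((Λ₁ - Λ₂) * ind (cls z) l + Λ₂)) * u l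
            ≈⟨ distribʳ (u l) _ _ ⟩
          (b * δ z l) * u l + ((Λ₁ - Λ₂) * ind (cls z) l + Λ₂) * u l
            ≈⟨ +-cong (*-assoc b _ (u l)) (distribʳ (u l) _ Λ₂) ⟩
          b * (δ z l * u l) + (((Λ₁ - Λ₂) * ind (cls z) l) * u l + Λ₂ * u l)
            ≈⟨ +-cong (*-congˡ (*-comm _ (u l))) (+-congʳ (*-assoc _ _ (u l))) ⟩
          b * (u l * δ z l) + rest l ∎

      SameClass : Set
      SameClass = Σ[ x ∈ Fin v ] Σ[ y ∈ Fin v ] cls x ≡ cls y

      pairVector : SameClass → Fin v → Carrier
      pairVector (x , y , _) l = δ x l - δ y l

      classVector : Fin m × Fin m → Fin v → Carrier
      classVector (i , j) l = ind i l - ind j l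

      A²-pairVector : ∀ p z → A[ A[ pairVector p ] ] z ≈ b * pairVector p z
      A²-pairVector (x , y , cls-x≡cls-y) z = begin
        A[ A[ w ] ] z
          ≈⟨ A²-LDDG w z ⟩
        b * w z + ((Λ₁ - Λ₂) * ⟨ ind (cls z) , w ⟩ + Λ₂ * sum w)
          ≈⟨ +-congˡ (+-cong (*-congˡ class-sum≈0) (*-congˡ sum≈0)) ⟩
        b * w z + ((Λ₁ - Λ₂) * 0# + Λ₂ * 0#)
          ≈⟨ +-congˡ (trans (+-cong (zeroʳ _) (zeroʳ Λ₂)) (+-identityʳ 0#)) ⟩
        b * w z + 0#
          ≈⟨ +-identityʳ _ ⟩
        b * w z ∎
        where
        w : Fin v → Carrier
        w l = δ x l - δ y l

        class-sum≈0 : ⟨ ind (cls z) , w ⟩ ≈ 0#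
        class-sum≈0 = trans (⟨⟩-δ-δ (ind (cls z)) x y)
          (trans (+-congˡ (-‿cong (≈-reflexive (≡.cong (λ c → 𝟙 ⌊ c ≟ cls z ⌋) (≡.sym cls-x≡cls-y)))))
                 (-‿inverseʳ _))

        sum≈0 : sum w ≈ 0#
        sum≈0 = trans (sum-cong-≋ (λ l → sym (*-identityˡ (w l))))
                      (trans (⟨⟩-δ-δ (λ _ → 1#) x y) (-‿inverseʳ 1#))

      ⟨ind,ind⟩ : ∀ c i → ⟨ ind c , ind i ⟩ ≈ N * 𝟙 ⌊ c ≟ i ⌋
      ⟨ind,ind⟩ c i = ∑-ind c (ind i) (λ l cls≡c → ≈-reflexive (≡.cong (λ c′ → 𝟙 ⌊ c′ ≟ i ⌋) cls≡c))

      ∑ind : ∀ i → sum (ind i) ≈ N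
      ∑ind i = trans (sum-cong-≋ (λ l → sym (*-identityʳ (ind i l))))
                     (trans (∑-ind i (λ _ → 1#) (λ _ _ → ≈-refl)) (*-identityʳ N))

      ∑classVector≈0 : ∀ p → sum (classVector p) ≈ 0#
      ∑classVector≈0 (i , j) =
        trans (∑-distrib-minus (ind i) (ind j)) (trans (+-cong (∑ind i) (-‿cong (∑ind j))) (-‿inverseʳ N))

      A²-classVector : ∀ p z → A[ A[ classVector p ] ] z ≈ a * classVector p z
      A²-classVector (i , j) z = begin
        A[ A[ w ] ] z
          ≈⟨ A²-LDDG w z ⟩
        b * w z + ((Λ₁ - Λ₂) * ⟨ ind (cls z) , w ⟩ + Λ₂ * sum w)
          ≈⟨ +-congˡ (+-cong (*-congˡ class-sum) (*-congˡ (∑classVector≈0 (i , j)))) ⟩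
        b * w z + ((Λ₁ - Λ₂) * (N * w z) + Λ₂ * 0#)
          ≈⟨ +-congˡ (trans (+-congˡ (zeroʳ Λ₂)) (+-identityʳ _)) ⟩
        b * w z + (Λ₁ - Λ₂) * (N * w z)
          ≈⟨ +-congˡ (trans (*-congʳ (*-comm N _)) (*-assoc _ N (w z))) ⟨
        b * w z + (N * (Λ₁ - Λ₂)) * w z
          ≈⟨ distribʳ (w z) b _ ⟨
        a * w z ∎
        where
        w : Fin v → Carrier
        w l = ind i l - ind j l

        class-sum : ⟨ ind (cls z) , w ⟩ ≈ N * w z
        class-sum = begin
          ⟨ ind (cls z) , w ⟩
            ≈⟨ ⟨⟩-distrib-minus (ind (cls z)) (ind i) (ind j) ⟩
          ⟨ ind (cls z) , ind i ⟩ - ⟨ ind (cls z) , ind j ⟩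
            ≈⟨ +-cong (⟨ind,ind⟩ (cls z) i) (-‿cong (⟨ind,ind⟩ (cls z) j)) ⟩
          N * ind i z - N * ind j z
            ≈⟨ x[y-z]≈xy-xz N (ind i z) (ind j z) ⟨
          N * w z ∎

      K*K-LDDG : ∀ z → K * K ≈ b + (Λ₁ * N + Λ₂ * fromℕ (outside z))
      K*K-LDDG z = begin
        K * K
          ≈⟨ A-const regular K z ⟨
        A[ (λ _ → K) ] z
          ≈⟨ A-cong (λ l → trans (A-const regular 1# l) (*-identityʳ K)) z ⟨
        A[ A[ 𝟏 ] ] z
          ≈⟨ A²-LDDG 𝟏 z ⟩
        b * 1# + ((Λ₁ - Λ₂) * ⟨ ind (cls z) , 𝟏 ⟩ + Λ₂ * sum 𝟏)
          ≈⟨ +-cong (*-identityʳ b) (+-cong (*-congˡ class-sum) (*-congˡ total)) ⟩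
        b + ((Λ₁ - Λ₂) * N + Λ₂ * (N + Out))
          ≈⟨ +-congˡ (+-congˡ (distribˡ Λ₂ N Out)) ⟩
        b + ((Λ₁ - Λ₂) * N + (Λ₂ * N + Λ₂ * Out))
          ≈⟨ +-congˡ (+-assoc _ _ _) ⟨
        b + (((Λ₁ - Λ₂) * N + Λ₂ * N) + Λ₂ * Out)
          ≈⟨ +-congˡ (+-congʳ (distribʳ N _ Λ₂)) ⟨
        b + (((Λ₁ - Λ₂) + Λ₂) * N + Λ₂ * Out)
          ≈⟨ +-congˡ (+-congʳ (*-congʳ (//-rightDividesˡ Λ₂ Λ₁))) ⟩
        b + (Λ₁ * N + Λ₂ * Out) ∎
        where
        𝟏 : Fin v → Carrier
        𝟏 _ = 1#
        Out : Carrier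
        Out = fromℕ (outside z)

        class-sum : ⟨ ind (cls z) , 𝟏 ⟩ ≈ N
        class-sum = trans (∑-ind (cls z) 𝟏 (λ _ _ → ≈-refl)) (*-identityʳ N)

        total : sum 𝟏 ≈ N + Out
        total = begin
          sum 𝟏
            ≈⟨ ∑-const {v} 1# ⟩
          fromℕ v * 1#
            ≈⟨ *-identityʳ _ ⟩
          fromℕ v
            ≡⟨ ≡.cong fromℕ (count-split (λ l → ⌊ cls l ≟ cls z ⌋)) ⟨
          fromℕ (count (λ l → ⌊ cls l ≟ cls z ⌋) ℕ.+ outside z)
            ≡⟨ ≡.cong (λ c → fromℕ (c ℕ.+ outside z)) (class-size (cls z)) ⟩
          fromℕ (n ℕ.+ outside z)
            ≈⟨ fromℕ-+ n (outside z) ⟩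
          N + Out ∎

      module _ (0<n : 0 ℕ.< n) where

        instance
          n≢0 : ℕ.NonZero n
          n≢0 = ℕ.>-nonZero 0<n

        K*K≉b : ∀ {z} → 0 ℕ.< outside z → λ₁ ≢ λ₂ → ¬ (K * K ≈ b)
        K*K≉b {z} 0<r λ₁≢λ₂ K*K≈b = λ₁≢λ₂ (≡.trans λ₁≡0 (≡.sym λ₂≡0))
          where
          instance
            r≢0 : ℕ.NonZero (outside z)
            r≢0 = ℕ.>-nonZero 0<r
          no-common-neighbours : λ₁ ℕ.* n ℕ.+ λ₂ ℕ.* outside z ≡ 0
          no-common-neighbours = fromℕ-injective (begin
            fromℕ (λ₁ ℕ.* n ℕ.+ λ₂ ℕ.* outside z)
              ≈⟨ trans (fromℕ-+ (λ₁ ℕ.* n) (λ₂ ℕ.* outside z)) (+-cong (fromℕ-* λ₁ n) (fromℕ-* λ₂ (outside z))) ⟩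
            Λ₁ * N + Λ₂ * fromℕ (outside z)
              ≈⟨ +-cancelˡ b _ _ (trans (sym (K*K-LDDG z)) (trans K*K≈b (sym (+-identityʳ b)))) ⟩
            0# ∎)
          λ₁≡0 : λ₁ ≡ 0
          λ₁≡0 = ℕₚ.m*n≡0⇒m≡0 λ₁ n (ℕₚ.m+n≡0⇒m≡0 (λ₁ ℕ.* n) no-common-neighbours)
          λ₂≡0 : λ₂ ≡ 0
          λ₂≡0 = ℕₚ.m*n≡0⇒m≡0 λ₂ (outside z) (ℕₚ.m+n≡0⇒n≡0 (λ₁ ℕ.* n) no-common-neighbours)

        K*K≉a : Fin v → λ₂ ≢ 0 → ¬ (K * K ≈ a)
        K*K≉a z λ₂≢0 K*K≈a = λ₂≢0 (ℕₚ.m*n≡0⇒m≡0 λ₂ n (ℕₚ.m+n≡0⇒n≡0 (λ₂ ℕ.* outside z) (fromℕ-injective (begin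
          fromℕ (λ₂ ℕ.* outside z ℕ.+ λ₂ ℕ.* n)
            ≈⟨ trans (fromℕ-+ (λ₂ ℕ.* outside z) (λ₂ ℕ.* n)) (+-cong (fromℕ-* λ₂ (outside z)) (fromℕ-* λ₂ n)) ⟩
          Λ₂ * Out + Λ₂ * N
            ≈⟨ +-congʳ Λ₂Out≈-Λ₂N ⟩
          - (Λ₂ * N) + Λ₂ * N
            ≈⟨ -‿inverseˡ _ ⟩
          0# ∎))))
          where
          Out : Carrier
          Out = fromℕ (outside z)

          Λ₂Out≈-Λ₂N : Λ₂ * Out ≈ - (Λ₂ * N)
          Λ₂Out≈-Λ₂N = +-cancelˡ (Λ₁ * N) _ _ (+-cancelˡ b _ _ (begin
            b + (Λ₁ * N + Λ₂ * Out)          ≈⟨ K*K-LDDG z ⟨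
            K * K                          ≈⟨ K*K≈a ⟩
            b + N * (Λ₁ - Λ₂)              ≈⟨ +-congˡ (x[y-z]≈xy-xz N Λ₁ Λ₂) ⟩
            b + (N * Λ₁ - N * Λ₂)          ≈⟨ +-congˡ (+-cong (*-comm N Λ₁) (-‿cong (*-comm N Λ₂))) ⟩
            b + (Λ₁ * N - Λ₂ * N)          ∎))

        a≉b : λ₁ ≢ λ₂ → ¬ (a ≈ b)
        a≉b λ₁≢λ₂ a≈b = λ₁≢λ₂ (ℕₚ.*-cancelˡ-≡ λ₁ λ₂ n (fromℕ-injective (begin
          fromℕ (n ℕ.* λ₁)
            ≈⟨ fromℕ-* n λ₁ ⟩
          N * Λ₁
            ≈⟨ x∙y⁻¹≈ε⇒x≈y _ _ (trans (sym (x[y-z]≈xy-xz N Λ₁ Λ₂)) N[Λ₁-Λ₂]≈0) ⟩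
          N * Λ₂
            ≈⟨ fromℕ-* n λ₂ ⟨
          fromℕ (n ℕ.* λ₂) ∎)))
          where
          N[Λ₁-Λ₂]≈0 : N * (Λ₁ - Λ₂) ≈ 0#
          N[Λ₁-Λ₂]≈0 = +-cancelˡ b _ _ (trans a≈b (sym (+-identityʳ b)))

      K*K≈a : Fin v → λ₂ ≡ 0 → K * K ≈ a
      K*K≈a z λ₂≡0 = begin
        K * K
          ≈⟨ K*K-LDDG z ⟩
        b + (Λ₁ * N + Λ₂ * fromℕ (outside z))
          ≈⟨ +-congˡ (+-cong (*-comm Λ₁ N) (trans (*-congʳ Λ₂≈0) (zeroˡ _))) ⟩
        b + (N * Λ₁ + 0#)
          ≈⟨ +-congˡ (trans (*-congˡ Λ₁-Λ₂≈Λ₁) (sym (+-identityʳ _))) ⟨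
        b + N * (Λ₁ - Λ₂) ∎
        where
        Λ₂≈0 : Λ₂ ≈ 0#
        Λ₂≈0 = ≈-reflexive (≡.cong fromℕ λ₂≡0)
        Λ₁-Λ₂≈Λ₁ : Λ₁ - Λ₂ ≈ Λ₁
        Λ₁-Λ₂≈Λ₁ = trans (+-congˡ (trans (-‿cong Λ₂≈0) -0#≈0#)) (+-identityʳ Λ₁)

      class-members : 2 ℕ.≤ n → ∀ i → ∃₂ λ x y → x ≢ y × cls x ≡ i × cls y ≡ i
      class-members 2≤n i with two-members (λ x → ⌊ cls x ≟ i ⌋) (≡.subst (2 ℕ.≤_) (≡.sym (class-size i)) 2≤n)
      ... | x , y , x≢y , x∈i , y∈i =
        x , y , x≢y , toWitness {a? = cls x ≟ i} x∈i , toWitness {a? = cls y ≟ i} y∈i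

      module Spectrum (connected : Connected G) (λ₁≢λ₂ : λ₁ ≢ λ₂) (0<n : 0 ℕ.< n)
                      {x₀ y₀ z₁ : Fin v} (x₀≢y₀ : x₀ ≢ y₀) (x₀~y₀ : cls x₀ ≡ cls y₀)
                      (x₀≁z₁ : cls x₀ ≢ cls z₁) {θ₁ θ₂ θ₃ : Carrier}
                      (at-most-three : ∀ μ → IsEigenvalue R G μ → μ ≈ θ₁ ⊎ μ ≈ θ₂ ⊎ μ ≈ θ₃)
                      where

        pair₀ : SameClass
        pair₀ = x₀ , y₀ , x₀~y₀

        classes₀ : Fin m × Fin m
        classes₀ = cls x₀ , cls z₁

        pair₀-x₀≉0 : ¬ (pairVector pair₀ x₀ ≈ 0#)
        pair₀-x₀≉0 = 1-0≉0 (𝟙≟-refl x₀) (𝟙≟-≢ x₀≢y₀)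

        classes₀-x₀≉0 : ¬ (classVector classes₀ x₀ ≈ 0#)
        classes₀-x₀≉0 = 1-0≉0 (𝟙≟-refl (cls x₀)) (𝟙≟-≢ x₀≁z₁)

        eig-K : IsEigenvalue R G K
        eig-K = eigenvector⇒eigenvalue (λ _ → 1#) x₀ 1≉0 (A-const regular 1#)

        0<outside : 0 ℕ.< outside x₀
        0<outside =
          member⇒count-pos (λ l → not ⌊ cls l ≟ cls x₀ ⌋) {z₁} (fromWitnessFalse (x₀≁z₁ ∘ ≡.sym))

        0<k : 0 ℕ.< k
        0<k with crossing-edge cls (connected x₀ z₁) x₀≁z₁
        ... | s , t , _ , s~t =
          ≡.subst (0 ℕ.<_) (regular s) (member⇒count-pos (adj G s) (≡.subst T (≡.sym s~t) _))

        K≉-K : ¬ (K ≈ - K)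
        K≉-K K≈-K = ℕₚ.<⇒≢ 0<k (≡.sym (fromℕ-injective (x≈-x⇒x≈0 K≈-K)))

        √b : ∃ λ sb → sb * sb ≈ b
        √b = sqrt b (A²-nonneg (pairVector pair₀) b (A²-pairVector pair₀) x₀ pair₀-x₀≉0)

        √a : ∃ λ sa → sa * sa ≈ a
        √a = sqrt a (A²-nonneg (classVector classes₀) a (A²-classVector classes₀) x₀ classes₀-x₀≉0)

        UniformActions : Set (c ⊔ ℓ)
        UniformActions = ∃₂ λ γ β → γ * γ ≈ b × β * β ≈ a × ActsAs pairVector γ × ActsAs classVector β

        uniform-actions-λ₂≡0 : λ₂ ≡ 0 → ∀ {sb} → sb * sb ≈ b → ¬ ¬ UniformActions
        uniform-actions-λ₂≡0 λ₂≡0 {sb} sb²≈b = do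
          inj₁ (γ , γ²≈b , acts-γ) ← square-root-dichotomy pairVector sb sb²≈b A²-pairVector
            where inj₂ both →
                    ⊥-elim (both-signs-exclude-two at-most-three both eig-K eig-−K K≉-K K²≉sb² −K²≉sb²)
          pure (γ , - K , γ²≈b , trans (-x*-x≈x*x K) K*K≈a′ , acts-γ , λ p i → pure (A≈-K p i))
          where
          K*K≈a′ : K * K ≈ a
          K*K≈a′ = K*K≈a x₀ λ₂≡0

          A≈-K : ∀ p i → A[ classVector p ] i ≈ (- K) * classVector p i
          A≈-K p = A²≈k²⇒A≈-k regular connected x₀ (classVector p)
                     (λ i → trans (A²-classVector p i) (*-congʳ (sym K*K≈a′))) (∑classVector≈0 p)

          eig-−K : IsEigenvalue R G (- K)
          eig-−K = eigenvector⇒eigenvalue (classVector classes₀) x₀ classes₀-x₀≉0 (A≈-K classes₀)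

          K²≉sb² : ¬ (K * K ≈ sb * sb)
          K²≉sb² K²≈sb² = K*K≉b 0<n 0<outside λ₁≢λ₂ (trans K²≈sb² sb²≈b)

          −K²≉sb² : ¬ (- K * - K ≈ sb * sb)
          −K²≉sb² −K²≈sb² = K²≉sb² (trans (sym (-x*-x≈x*x K)) −K²≈sb²)

        uniform-actions-λ₂≢0 : λ₂ ≢ 0 → ∀ {sb sa} → sb * sb ≈ b → sa * sa ≈ a → ¬ ¬ UniformActions
        uniform-actions-λ₂≢0 λ₂≢0 {sb} {sa} sb²≈b sa²≈a = do
          on-pairs   ← square-root-dichotomy pairVector sb sb²≈b A²-pairVector
          on-classes ← square-root-dichotomy classVector sa sa²≈a A²-classVector
          combine on-pairs on-classes
          where
          K²≉a : ¬ (K * K ≈ a)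
          K²≉a = K*K≉a 0<n x₀ λ₂≢0
          K²≉b : ¬ (K * K ≈ b)
          K²≉b = K*K≉b 0<n 0<outside λ₁≢λ₂

          combine : Uniform pairVector b ⊎ BothSigns sb → Uniform classVector a ⊎ BothSigns sa →
                    ¬ ¬ UniformActions
          combine (inj₁ (γ , γ²≈b , acts-γ)) (inj₁ (β , β²≈a , acts-β)) =
            pure (γ , β , γ²≈b , β²≈a , acts-γ , acts-β)
          combine (inj₂ both) on-classes = do
            μ , μ²≈a , eig-μ ← square-root-eigenvalue classVector classes₀ x₀ classes₀-x₀≉0 sa²≈a on-classes
            ⊥-elim (both-signs-exclude-two at-most-three both eig-K eig-μ
              (λ K≈μ → K²≉a (trans (*-cong K≈μ K≈μ) μ²≈a))
              (λ K²≈sb² → K²≉b (trans K²≈sb² sb²≈b))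
              (λ μ²≈sb² → a≉b 0<n λ₁≢λ₂ (trans (sym μ²≈a) (trans μ²≈sb² sb²≈b))))
          combine on-pairs@(inj₁ _) (inj₂ both) = do
            μ , μ²≈b , eig-μ ← square-root-eigenvalue pairVector pair₀ x₀ pair₀-x₀≉0 sb²≈b on-pairs
            ⊥-elim (both-signs-exclude-two at-most-three both eig-K eig-μ
              (λ K≈μ → K²≉b (trans (*-cong K≈μ K≈μ) μ²≈b))
              (λ K²≈sa² → K²≉a (trans K²≈sa² sa²≈a))
              (λ μ²≈sa² → a≉b 0<n λ₁≢λ₂ (trans (sym (trans μ²≈sa² sa²≈a)) μ²≈b)))

        uniform-actions : ¬ ¬ UniformActions
        uniform-actions with √b | √a | λ₂ ℕ.≟ 0
        ... | _ , sb²≈b | _         | yes λ₂≡0 = uniform-actions-λ₂≡0 λ₂≡0 sb²≈b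
        ... | _ , sb²≈b | _ , sa²≈a | no  λ₂≢0 = uniform-actions-λ₂≢0 λ₂≢0 sb²≈b sa²≈a

      module Rigidity (connected : Connected G) (2≤n : 2 ℕ.≤ n) (λ₁≢λ₂ : λ₁ ≢ λ₂)
                      {x₀ z₁ : Fin v} (x₀≁z₁ : cls x₀ ≢ cls z₁)
                      {γ β : Carrier} (γ²≈b : γ * γ ≈ b) (β²≈a : β * β ≈ a)
                      (acts-γ : ActsAs pairVector γ) (acts-β : ActsAs classVector β) where

        e : Fin v → Fin v → Carrier
        e x y = 𝟙 (adj G x y)

        gap : Fin v → Fin v → Carrier
        gap x y = (e x x - γ) - e x y

        0<n : 0 ℕ.< n
        0<n = ℕₚ.<-trans (s≤s z≤n) 2≤n

        column-equal : ∀ {x y z} → cls x ≡ cls y → z ≢ x → z ≢ y → adj G z x ≡ adj G z y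
        column-equal {x} {y} {z} x~y z≢x z≢y = Bool-stable do
          A-eq ← acts-γ (x , y , x~y) z
          pure (𝟙-injective (x∙y⁻¹≈ε⇒x≈y _ _ (begin
            e z x - e z y
              ≈⟨ ⟨⟩-δ-δ (e z) x y ⟨
            A[ pairVector (x , y , x~y) ] z
              ≈⟨ A-eq ⟩
            γ * (δ x z - δ y z)
              ≈⟨ *-congˡ (trans (+-cong (𝟙≟-≢ z≢x) (-‿cong (𝟙≟-≢ z≢y))) (-‿inverseʳ 0#)) ⟩
            γ * 0#
              ≈⟨ zeroʳ γ ⟩
            0# ∎)))

        gap-within : ∀ {x y} → x ≢ y → cls x ≡ cls y → ¬ ¬ (gap x y ≈ 0#)
        gap-within {x} {y} x≢y x~y = do
          A-eq ← acts-γ (x , y , x~y) x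
          pure (x≈y⇒x∙y⁻¹≈ε (x-y≈z⇒x-z≈y (begin
            e x x - e x y                    ≈⟨ ⟨⟩-δ-δ (e x) x y ⟨
            A[ pairVector (x , y , x~y) ] x  ≈⟨ A-eq ⟩
            γ * (δ x x - δ y x)              ≈⟨ *-congˡ (1-0≈1 (𝟙≟-refl x) (𝟙≟-≢ x≢y)) ⟩
            γ * 1#                           ≈⟨ *-identityʳ γ ⟩
            γ                                ∎)))

        partner : ∀ z → ∃ λ w → z ≢ w × cls z ≡ cls w
        partner z with class-members 2≤n (cls z)
        ... | x , y , x≢y , x∈ , y∈ with z ≟ x
        ...   | yes refl = y , x≢y , ≡.sym y∈
        ...   | no z≢x   = x , z≢x , ≡.sym x∈

        gap-across : ∀ {z y} → cls z ≢ cls y → ¬ ¬ (N * gap z y ≈ β - γ)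
        gap-across {z} {y} z≁y with partner z
        ... | w , z≢w , z~w = do
          gap-zw≈0 ← gap-within z≢w z~w
          A-eq ← acts-β (cls z , cls y) z
          pure (begin
            N * gap z y
              ≈⟨ x[y-z]≈xy-xz N (e z z - γ) (e z y) ⟩
            N * (e z z - γ) - N * e z y
              ≈⟨ //-rightDividesʳ γ _ ⟨
            (N * (e z z - γ) - N * e z y) + γ - γ
              ≈⟨ +-congʳ ([x+y]-z≈[x-z]+y _ γ _) ⟨
            (N * (e z z - γ) + γ) - N * e z y - γ
              ≈⟨ +-congʳ (+-cong (row-within (sym (x∙y⁻¹≈ε⇒x≈y _ _ gap-zw≈0))) (-‿cong row-across)) ⟨
            ⟨ ind (cls z) , e z ⟩ - ⟨ ind (cls y) , e z ⟩ - γ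
              ≈⟨ +-congʳ (+-cong (⟨⟩-comm _ (e z)) (-‿cong (⟨⟩-comm _ (e z)))) ⟩
            ⟨ e z , ind (cls z) ⟩ - ⟨ e z , ind (cls y) ⟩ - γ
              ≈⟨ +-congʳ (⟨⟩-distrib-minus (e z) (ind (cls z)) (ind (cls y))) ⟨
            A[ classVector (cls z , cls y) ] z - γ
              ≈⟨ +-congʳ A-eq ⟩
            β * (ind (cls z) z - ind (cls y) z) - γ
              ≈⟨ +-congʳ (trans (*-congˡ (1-0≈1 (𝟙≟-refl (cls z)) (𝟙≟-≢ z≁y))) (*-identityʳ β)) ⟩
            β - γ ∎)
          where
          row-across : ⟨ ind (cls y) , e z ⟩ ≈ N * e z y
          row-across = ∑-ind (cls y) (e z) (λ l l~y →
            ≈-reflexive (≡.cong 𝟙 (column-equal l~y (λ z≡l → z≁y (≡.trans (≡.cong cls z≡l) l~y))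
                                                    (λ z≡y → z≁y (≡.cong cls z≡y)))))

          row-within : e z w ≈ e z z - γ → ⟨ ind (cls z) , e z ⟩ ≈ N * (e z z - γ) + γ
          row-within e-zw≈ = trans
            (∑-ind-except z (e z) (λ l l~z l≢z →
              trans (≈-reflexive (≡.cong 𝟙 (column-equal (≡.trans l~z z~w) (l≢z ∘ ≡.sym) z≢w))) e-zw≈))
            (+-congˡ (x-[x-y]≈y (e z z) γ))

        gap-symmetric : ∀ {x y} → gap x y ≈ gap y x → adj G x x ≡ adj G y y
        gap-symmetric {x} {y} gap≈ = 𝟙-injective (x-z≈y-z⇒x≈y (x-z≈y-z⇒x≈y (begin
          (e x x - γ) - e x y  ≈⟨ gap≈ ⟩
          (e y y - γ) - e y x  ≡⟨ ≡.cong (λ t → (e y y - γ) - 𝟙 t) (adj-sym G y x) ⟩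
          (e y y - γ) - e x y  ∎)))

        gap-equal : ∀ {x y x′ y′} → gap x y ≈ gap x′ y′ → adj G x x ≡ adj G x′ x′ →
                    adj G x y ≡ adj G x′ y′
        gap-equal gap≈ loops≡ =
          𝟙-injective (x-y≈x′-z⇒y≈z (+-congʳ (≈-reflexive (≡.cong 𝟙 loops≡))) gap≈)

        N-cancel : ∀ {s t} → N * s ≈ β - γ → N * t ≈ β - γ → s ≈ t
        N-cancel Ns≈ Nt≈ = *-cancelˡ (fromℕ-nonZero {{ℕ.>-nonZero 0<n}}) (trans Ns≈ (sym Nt≈))

        uniform-loops : ∀ x y → adj G x x ≡ adj G y y
        uniform-loops x y with x ≟ y | cls x ≟ cls y
        ... | yes refl | _ = refl
        ... | no x≢y | yes x~y = Bool-stable do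
          gap-xy≈0 ← gap-within x≢y x~y
          gap-yx≈0 ← gap-within (x≢y ∘ ≡.sym) (≡.sym x~y)
          pure (gap-symmetric (trans gap-xy≈0 (sym gap-yx≈0)))
        ... | no _ | no x≁y = Bool-stable do
          N-gap-xy ← gap-across x≁y
          N-gap-yx ← gap-across (x≁y ∘ ≡.sym)
          pure (gap-symmetric (N-cancel N-gap-xy N-gap-yx))

        crossing : ∃₂ λ u w → cls u ≢ cls w × adj G u w ≡ true
        crossing = crossing-edge cls (connected x₀ z₁) x₀≁z₁

        adjacent-across : ∀ x y → cls x ≢ cls y → adj G x y ≡ true
        adjacent-across x y x≁y with crossing
        ... | u , w , u≁w , u~w = Bool-stable do
          N-gap-xy ← gap-across x≁y
          N-gap-uw ← gap-across u≁w
          pure (≡.trans (gap-equal (N-cancel N-gap-xy N-gap-uw) (uniform-loops x u)) u~w)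

        nonadjacent-within : ∀ x y → x ≢ y → cls x ≡ cls y → adj G x y ≡ false
        nonadjacent-within x y x≢y x~y with crossing
        ... | u , w , u≁w , u~w = Bool-stable do
          gap-xy≈0 ← gap-within x≢y x~y
          N-gap-uw ← gap-across u≁w
          pure (¬-not λ x-adj-y → a≉b 0<n λ₁≢λ₂ (begin
            a       ≈⟨ β²≈a ⟨
            β * β   ≈⟨ *-cong (β≈γ gap-xy≈0 N-gap-uw x-adj-y) (β≈γ gap-xy≈0 N-gap-uw x-adj-y) ⟩
            γ * γ   ≈⟨ γ²≈b ⟩
            b       ∎))
          where
          β≈γ : gap x y ≈ 0# → N * gap u w ≈ β - γ → adj G x y ≡ true → β ≈ γ
          β≈γ gap-xy≈0 N-gap-uw x-adj-y = x∙y⁻¹≈ε⇒x≈y β γ (begin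
            β - γ        ≈⟨ N-gap-uw ⟨
            N * gap u w  ≈⟨ *-congˡ gap-uw≈gap-xy ⟩
            N * gap x y  ≈⟨ *-congˡ gap-xy≈0 ⟩
            N * 0#       ≈⟨ zeroʳ N ⟩
            0#           ∎)
            where
            gap-uw≈gap-xy : gap u w ≈ gap x y
            gap-uw≈gap-xy = begin
              (e u u - γ) - e u w
                ≡⟨ ≡.cong₂ (λ s t → (𝟙 s - γ) - 𝟙 t) (uniform-loops u x) (≡.trans u~w (≡.sym x-adj-y)) ⟩
              (e x x - γ) - e x y ∎

        complete-multipartite : IsCompleteMultipartite G cls
        complete-multipartite = record
          { uniform-loops      = uniform-loops
          ; adjacent-across    = adjacent-across
          ; nonadjacent-within = nonadjacent-within
          }

      three-eigenvalues⇒complete-multipartite :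
        2 ℕ.≤ m → 2 ℕ.≤ n → λ₁ ≢ λ₂ → Connected G →
        ∀ {θ₁ θ₂ θ₃} → (∀ μ → IsEigenvalue R G μ → μ ≈ θ₁ ⊎ μ ≈ θ₂ ⊎ μ ≈ θ₃) →
        IsCompleteMultipartite G cls
      three-eigenvalues⇒complete-multipartite 2≤m 2≤n λ₁≢λ₂ connected at-most-three with two-elements 2≤m
      ... | i₀ , i₁ , i₀≢i₁ with class-members 2≤n i₀ | class-members 2≤n i₁
      ...   | x₀ , y₀ , x₀≢y₀ , x₀∈i₀ , y₀∈i₀ | z₁ , _ , _ , z₁∈i₁ , _ = IsCompleteMultipartite-stable do
        γ , β , γ²≈b , β²≈a , acts-γ , acts-β ←
          Spectrum.uniform-actions connected λ₁≢λ₂ (ℕₚ.<-trans (s≤s z≤n) 2≤n)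
                                   x₀≢y₀ (≡.trans x₀∈i₀ (≡.sym y₀∈i₀)) x₀≁z₁ at-most-three
        pure (Rigidity.complete-multipartite connected 2≤n λ₁≢λ₂ x₀≁z₁ γ²≈b β²≈a acts-γ acts-β)
        where
        x₀≁z₁ : cls x₀ ≢ cls z₁
        x₀≁z₁ x₀~z₁ = i₀≢i₁ (≡.trans (≡.sym x₀∈i₀) (≡.trans x₀~z₁ z₁∈i₁))

proposition3p12 : ∀ {c ℓ ℓ' : Level} (R : RealClosedField c ℓ ℓ')
    {v k λ₁ λ₂ m n : ℕ} (G : Graph v) →
    IsProperLDDG G k λ₁ λ₂ m n → Connected G → HasExactlyThreeEigenvalues R G →
    IsomorphicTo G (multipartiteAdj {m} {n}) ⊎ IsomorphicTo G (loopedMultipartiteAdj {m} {n})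
proposition3p12 R {v} G ((regular , partition) , 2≤m , 2≤n , λ₁≢λ₂) connected
                (_ , _ , _ , _ , _ , _ , _ , _ , _ , at-most-three) =
  complete-multipartite-iso class-size
    (three-eigenvalues⇒complete-multipartite 2≤m 2≤n λ₁≢λ₂ connected at-most-three) x₀
  where
  open LDDGPartition partition using (class-size)
  open LDDG R G regular partition

  x₀ : Fin v
  x₀ = proj₁ (class-members 2≤n (proj₁ (two-elements 2≤m)))
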